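{- Let $V$ be a finite set and let $\rho_1, \rho_2$ be permutations of $V$. Let $\rho_0 = \rho_2 \rho_1^{ -1}$ (i.e.\ $\rho_0(i) = \rho_2(\rho_1^{ -1}(i))$). Let $C(\rho_1,\rho_2) = (c_{i,j})_{i,j \in V}$ be the matrix with $c_{i,j} = \#\{ k \in \{1,2\} : \rho_k(i) = j\}$. Then $\det C(\rho_1,\rho_2) = 0$ if $\rho_0$ has at least one cycle of even length, and $\det C(\rho_1,\rho_2) = \operatorname{sign}(\rho_1) \cdot 2^{\mathrm{cl}(\rho_0)}$ otherwise, where $\mathrm{cl}(\rho_0)$ is the number of cycles of $\rho_0$ (fixed points counted as cycles of length $1$).
   Context: $C(\rho_1,\rho_2)$ is the adjacency matrix of the directed graph on $V$ with edges $i \to \rho_1(i)$ and $i \to \rho_2(i)$, where a coincidence $\rho_1(i) = \rho_2(i)$ gives entry $2$. The determinant is taken with rows and columns indexed by $V$ in the same order. $\operatorname{sign}$ denotes the sign of a permutation. -}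

module Defs where

open import Data.Nat as ℕ using (ℕ; zero; suc)
open import Data.Nat.Properties using (_≤?_)
open import Data.Fin using (Fin; zero; suc; toℕ; punchIn; _≟_)
open import Data.Fin.Permutation using (Permutation′; _⟨$⟩ʳ_; _⟨$⟩ˡ_)
open import Data.Integer as ℤ using (ℤ; +_; -_)
open import Data.List using (List; []; _∷_; length; filter; upTo; allFin; sum; map; concatMap)
open import Data.List.Relation.Unary.All using (all?)
open import Data.Bool using (Bool; true; false; if_then_else_)
open import Data.Product using (Σ; _×_; _,_; ∃)
open import Relation.Nullary using (¬_; Dec; yes; no; does)
open import Relation.Binary.PropositionalEquality using (_≡_)
open import Data.Nat.Divisibility using (_∣_)

Matrix : ℕ → Set
Matrix n = Fin n → Fin n → ℤ

Σᶠ : ∀ {n} → (Fin n → ℤ) → ℤ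
Σᶠ {zero}  f = + 0
Σᶠ {suc n} f = f zero ℤ.+ Σᶠ (λ i → f (suc i))

negOnePow : ℕ → ℤ
negOnePow zero = + 1
negOnePow (suc k) = - negOnePow k

det : ∀ {n} → Matrix n → ℤ
det {zero}  M = + 1
det {suc n} M =
  Σᶠ (λ j → negOnePow (toℕ j) ℤ.* (M zero j ℤ.* det (λ r c → M (suc r) (punchIn j c))))

indic : ∀ {n} → Fin n → Fin n → ℤ
indic a b = if does (a ≟ b) then + 1 else + 0

Cmat : ∀ {n} → Permutation′ n → Permutation′ n → Matrix n
Cmat ρ₁ ρ₂ i j = indic (ρ₁ ⟨$⟩ʳ i) j ℤ.+ indic (ρ₂ ⟨$⟩ʳ i) j

rho0 : ∀ {n} → Permutation′ n → Permutation′ n → Fin n → Fin n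
rho0 ρ₁ ρ₂ i = ρ₂ ⟨$⟩ʳ (ρ₁ ⟨$⟩ˡ i)

inversions : ∀ {n} → Permutation′ n → ℕ
inversions {n} σ =
  length (filter (λ p → Data.Nat._<?_ (toℕ (σ ⟨$⟩ʳ Data.Product.proj₂ p)) (toℕ (σ ⟨$⟩ʳ Data.Product.proj₁ p)))
    (filter (λ p → Data.Nat._<?_ (toℕ (Data.Product.proj₁ p)) (toℕ (Data.Product.proj₂ p)))
      (concatMap (λ i → map (λ j → (i , j)) (allFin n)) (allFin n))))
  where import Data.Nat; import Data.Product

sign : ∀ {n} → Permutation′ n → ℤ
sign σ = negOnePow (inversions σ)

iter : ∀ {n} → (Fin n → Fin n) → ℕ → Fin n → Fin n
iter f zero    i = i
iter f (suc k) i = f (iter f k i)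

OnCycleOfLength : ∀ {n} → (Fin n → Fin n) → Fin n → ℕ → Set
OnCycleOfLength f i k =
  (1 ℕ.≤ k) × (iter f k i ≡ i) × (∀ m → 1 ℕ.≤ m → m ℕ.< k → ¬ (iter f m i ≡ i))

HasEvenCycle : ∀ {n} → (Fin n → Fin n) → Set
HasEvenCycle {n} f = Σ (Fin n) λ i → Σ ℕ λ k → OnCycleOfLength f i k × (2 ∣ k)
  where import Data.Nat

-- i is the least element (in the order of Fin n) of its f-orbit.
-- (For a permutation of Fin n every orbit element is reached in < n steps.)
isCycleMin : ∀ {n} → (Fin n → Fin n) → Fin n → Bool
isCycleMin {n} f i = does (all? (λ k → toℕ i ≤? toℕ (iter f k i)) (upTo n))

-- cl(f): number of cycles of f (fixed points included) = number of orbit minima.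
cl : ∀ {n} → (Fin n → Fin n) → ℕ
cl {n} f = length (filter (λ i → isCycleMin f i Data.Bool.≟ true) (allFin n))
  where import Data.Bool

module Submission where

-- Expand det C(ρ₁, ρ₂) along its first row, for the more general matrix whose ρ₂-entry in row i is
-- a weight w i = ±1.  With a = ρ₁ 0, the first row is (1 + w 0) eₐ if ρ₂ 0 = a, and becomes eₐ after
-- a column operation otherwise.  Either way the minor is again such a matrix, for a pair whose ρ₀ is
-- ρ₀ with a cut out of its cycle: a fixed point disappears, otherwise its predecessor is joined to
-- its successor by an edge carrying the product of the two weights, negated.  Thus the sign picks up
-- (-1)^a, the number of cycles drops by one exactly when a is fixed, and each cycle keeps its
-- weight ∏ (- w) along the cycle.  By induction, det = 0 if some cycle has weight 1, and
-- det = sign ρ₁ · 2^cl(ρ₀) otherwise; for w = 1 the weight of a cycle is (-1)^length.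
open import Defs
open import Algebra.Properties.CommutativeMonoid.Sum as MonoidSum using ()
open import Data.Bool as Bool using (true; false; if_then_else_)
open import Data.Empty using (⊥-elim)
open import Data.Fin as Fin using (Fin; zero; suc; toℕ; punchIn; punchOut; _≟_; fromℕ<)
import Data.Fin.Properties as Finₚ
open import Data.Fin.Permutation as Perm using (Permutation′; _⟨$⟩ʳ_; _⟨$⟩ˡ_; remove; transpose; _∘ₚ_)
open import Data.Integer using (ℤ; +_; -_; _+_; _*_; _^_; 0ℤ; 1ℤ; -1ℤ)
import Data.Integer.Properties as ℤₚ
open import Data.Integer.Tactic.RingSolver using (solve-∀)
open import Data.List as List using (List; []; _∷_; _++_; length; filter; concatMap; tabulate; allFin; upTo)
import Data.List.Properties as Listₚ
import Data.List.Relation.Unary.All as All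
import Data.List.Membership.Propositional.Properties as Membershipₚ
open import Data.Nat as ℕ using (ℕ; zero; suc; _≤?_; _<?_)
import Data.Nat.Properties as ℕₚ
open import Data.Nat.DivMod using (_%_; _/_; m≡m%n+[m/n]*n; m%n<n)
open import Data.Nat.Divisibility using (_∣_; _∣0; ∣-refl; ∣m∣n⇒∣m+n; ∣m+n∣m⇒∣n; ∣1⇒≡1)
open import Data.Nat.Induction using (<-wellFounded)
open import Data.Nat.ListAction using (sum)
import Data.Nat.ListAction.Properties as ListActionₚ
open import Data.Product using (_×_; _,_; proj₁; proj₂; ∃; ∃-syntax; Σ)
open import Data.Sum using (_⊎_; inj₁; inj₂; [_,_]′)
open import Function using (_∘_; Injective; _⇔_; mk⇔; Equivalence)
open import Induction.WellFounded using (Acc; acc)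
open import Relation.Binary.Definitions using (tri<; tri≈; tri>)
open import Relation.Binary.PropositionalEquality
open import Relation.Nullary using (¬_; Dec; yes; no; does; _×-dec_; _→-dec_; ¬?)
open import Relation.Nullary.Decidable using (dec-true; dec-false; does-⇔; map′)
open import Relation.Unary using (Pred; Decidable)
open ≡-Reasoning
open Equivalence using (to; from)

module ℕΣ = MonoidSum ℕₚ.+-0-commutativeMonoid
open ℕΣ using (sum-syntax)
module ℤΠ = MonoidSum ℤₚ.*-1-commutativeMonoid
open ℤΠ using () renaming (sum to ∏)

-- Determinants

Σᶠ-cong : ∀ {n} {f g : Fin n → ℤ} → (∀ i → f i ≡ g i) → Σᶠ f ≡ Σᶠ g
Σᶠ-cong {zero}  f≗g = refl
Σᶠ-cong {suc n} f≗g = cong₂ _+_ (f≗g zero) (Σᶠ-cong (f≗g ∘ suc))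

Σᶠ-zero : ∀ {n} {f : Fin n → ℤ} → (∀ i → f i ≡ 0ℤ) → Σᶠ f ≡ 0ℤ
Σᶠ-zero {zero}  f≗0 = refl
Σᶠ-zero {suc n} f≗0 = cong₂ _+_ (f≗0 zero) (Σᶠ-zero (f≗0 ∘ suc))

Σᶠ-linear : ∀ {n} (f g : Fin n → ℤ) t → Σᶠ (λ i → f i + t * g i) ≡ Σᶠ f + t * Σᶠ g
Σᶠ-linear {zero}  f g t = sym (trans (ℤₚ.+-identityˡ (t * 0ℤ)) (ℤₚ.*-zeroʳ t))
Σᶠ-linear {suc n} f g t = begin
  (f zero + t * g zero) + Σᶠ (λ i → f (suc i) + t * g (suc i))
    ≡⟨ cong (_+_ (f zero + t * g zero)) (Σᶠ-linear (f ∘ suc) (g ∘ suc) t) ⟩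
  (f zero + t * g zero) + (Σᶠ (f ∘ suc) + t * Σᶠ (g ∘ suc))
    ≡⟨ interchange (f zero) (g zero) t (Σᶠ (f ∘ suc)) (Σᶠ (g ∘ suc)) ⟩
  (f zero + Σᶠ (f ∘ suc)) + t * (g zero + Σᶠ (g ∘ suc))  ∎
  where
  interchange : ∀ a b t c d → (a + t * b) + (c + t * d) ≡ (a + c) + t * (b + d)
  interchange = solve-∀

Σᶠ-single : ∀ {n} (f : Fin n → ℤ) a → (∀ j → j ≢ a → f j ≡ 0ℤ) → Σᶠ f ≡ f a
Σᶠ-single {suc n} f zero    f≗0 =
  trans (cong (_+_ (f zero)) (Σᶠ-zero (λ i → f≗0 (suc i) λ ()))) (ℤₚ.+-identityʳ (f zero))
Σᶠ-single {suc n} f (suc a) f≗0 =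
  trans (cong₂ _+_ (f≗0 zero λ ()) (Σᶠ-single (f ∘ suc) a (λ j j≢a → f≗0 (suc j) (j≢a ∘ Finₚ.suc-injective))))
        (ℤₚ.+-identityˡ (f (suc a)))

Σᶠ-pair : ∀ {n} (f : Fin n → ℤ) {a b} → a ≢ b → (∀ j → j ≢ a → j ≢ b → f j ≡ 0ℤ) → Σᶠ f ≡ f a + f b
Σᶠ-pair f {zero}  {zero}  a≢b _   = ⊥-elim (a≢b refl)
Σᶠ-pair f {zero}  {suc b} _   f≗0 =
  cong (_+_ (f zero)) (Σᶠ-single (f ∘ suc) b (λ j j≢b → f≗0 (suc j) (λ ()) (j≢b ∘ Finₚ.suc-injective)))
Σᶠ-pair f {suc a} {zero}  _   f≗0 =
  trans (cong (_+_ (f zero)) (Σᶠ-single (f ∘ suc) a (λ j j≢a → f≗0 (suc j) (j≢a ∘ Finₚ.suc-injective) (λ ()))))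
        (ℤₚ.+-comm (f zero) (f (suc a)))
Σᶠ-pair f {suc a} {suc b} a≢b f≗0 =
  trans (cong₂ _+_ (f≗0 zero (λ ()) (λ ()))
          (Σᶠ-pair (f ∘ suc) (a≢b ∘ cong suc)
            (λ j j≢a j≢b → f≗0 (suc j) (j≢a ∘ Finₚ.suc-injective) (j≢b ∘ Finₚ.suc-injective))))
        (ℤₚ.+-identityˡ _)

minor : ∀ {n} → Matrix (suc n) → Fin (suc n) → Matrix n
minor M j r c = M (suc r) (punchIn j c)

laplaceTerm : ∀ {n} → Matrix (suc n) → Fin (suc n) → ℤ
laplaceTerm M j = negOnePow (toℕ j) * (M zero j * det (minor M j))

det-cong : ∀ {n} {M N : Matrix n} → (∀ i j → M i j ≡ N i j) → det M ≡ det N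
det-cong {zero}  M≗N = refl
det-cong {suc n} M≗N = Σᶠ-cong λ j →
  cong₂ (λ m d → negOnePow (toℕ j) * (m * d)) (M≗N zero j) (det-cong (λ r c → M≗N (suc r) (punchIn j c)))

det-single-entry-first-row : ∀ {n} (M : Matrix (suc n)) a → (∀ j → j ≢ a → M zero j ≡ 0ℤ) →
  det M ≡ negOnePow (toℕ a) * (M zero a * det (minor M a))
det-single-entry-first-row M a M₀≗0 = Σᶠ-single (laplaceTerm M) a λ j j≢a → begin
  negOnePow (toℕ j) * (M zero j * det (minor M j))
    ≡⟨ cong (λ m → negOnePow (toℕ j) * (m * det (minor M j))) (M₀≗0 j j≢a) ⟩
  negOnePow (toℕ j) * (0ℤ * det (minor M j))        ≡⟨ ℤₚ.*-zeroʳ (negOnePow (toℕ j)) ⟩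
  0ℤ                                                ∎

laplaceTerm-zero-minor : ∀ {n} (M : Matrix (suc n)) j → det (minor M j) ≡ 0ℤ → laplaceTerm M j ≡ 0ℤ
laplaceTerm-zero-minor M j d≡0 = begin
  negOnePow (toℕ j) * (M zero j * det (minor M j))  ≡⟨ cong (λ d → negOnePow (toℕ j) * (M zero j * d)) d≡0 ⟩
  negOnePow (toℕ j) * (M zero j * 0ℤ)               ≡⟨ cong (negOnePow (toℕ j) *_) (ℤₚ.*-zeroʳ (M zero j)) ⟩
  negOnePow (toℕ j) * 0ℤ                            ≡⟨ ℤₚ.*-zeroʳ (negOnePow (toℕ j)) ⟩
  0ℤ                                                ∎

withColumn : ∀ {n} → Fin n → (Fin n → ℤ) → Matrix n → Matrix n
withColumn c x M i l with l ≟ c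
... | yes _ = x i
... | no  _ = M i l

withColumn-≡ : ∀ {n} c x (M : Matrix n) i → withColumn c x M i c ≡ x i
withColumn-≡ c x M i with c ≟ c
... | yes _   = refl
... | no  c≢c = ⊥-elim (c≢c refl)

withColumn-≢ : ∀ {n} {c l} x (M : Matrix n) i → l ≢ c → withColumn c x M i l ≡ M i l
withColumn-≢ {c = c} {l} x M i l≢c with l ≟ c
... | yes l≡c = ⊥-elim (l≢c l≡c)
... | no  _   = refl

withColumn-cong : ∀ {n} c x {M N : Matrix n} i l → M i l ≡ N i l → withColumn c x M i l ≡ withColumn c x N i l
withColumn-cong c x i l Mil≡Nil with l ≟ c
... | yes _ = refl
... | no  _ = Mil≡Nil

withColumn-self : ∀ {n} c (M : Matrix n) i l → withColumn c (λ r → M r c) M i l ≡ M i l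
withColumn-self c M i l with l ≟ c
... | yes refl = refl
... | no  _    = refl

punchIn-≢-punchOut : ∀ {n} {j c : Fin (suc n)} (j≢c : j ≢ c) {k} → k ≢ punchOut j≢c → punchIn j k ≢ c
punchIn-≢-punchOut {j = j} j≢c {k} k≢c′ eq =
  k≢c′ (Finₚ.punchIn-injective j k _ (trans eq (sym (Finₚ.punchIn-punchOut j≢c))))

det-linear : ∀ {n} (M X Y : Matrix n) c t →
  (∀ i l → l ≢ c → M i l ≡ X i l) → (∀ i l → l ≢ c → M i l ≡ Y i l) →
  (∀ i → M i c ≡ X i c + t * Y i c) → det M ≡ det X + t * det Y
det-linear {suc n} M X Y c t M≈X M≈Y Mc≡ =
  trans (Σᶠ-cong term-linear) (Σᶠ-linear (laplaceTerm X) (laplaceTerm Y) t)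
  where
  distribute : ∀ s x t y d → s * ((x + t * y) * d) ≡ s * (x * d) + t * (s * (y * d))
  distribute = solve-∀
  term-linear : ∀ j → laplaceTerm M j ≡ laplaceTerm X j + t * laplaceTerm Y j
  term-linear j with j ≟ c
  ... | yes refl = begin
    s * (M zero j * det (minor M j))              ≡⟨ cong (λ m → s * (m * det (minor M j))) (Mc≡ zero) ⟩
    s * ((X zero j + t * Y zero j) * det (minor M j))
      ≡⟨ distribute s (X zero j) t (Y zero j) (det (minor M j)) ⟩
    s * (X zero j * det (minor M j)) + t * (s * (Y zero j * det (minor M j)))
      ≡⟨ cong₂ (λ d d′ → s * (X zero j * d) + t * (s * (Y zero j * d′)))
           (det-cong (λ r k → M≈X (suc r) (punchIn j k) (Finₚ.punchInᵢ≢i j k)))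
           (det-cong (λ r k → M≈Y (suc r) (punchIn j k) (Finₚ.punchInᵢ≢i j k))) ⟩
    s * (X zero j * det (minor X j)) + t * (s * (Y zero j * det (minor Y j)))  ∎
    where
    s : ℤ
    s = negOnePow (toℕ j)
  ... | no j≢c = begin
    s * (M zero j * det (minor M j))
      ≡⟨ cong (λ d → s * (M zero j * d)) minor-linear ⟩
    s * (M zero j * (det (minor X j) + t * det (minor Y j)))
      ≡⟨ distribute′ s (M zero j) (det (minor X j)) t (det (minor Y j)) ⟩
    s * (M zero j * det (minor X j)) + t * (s * (M zero j * det (minor Y j)))
      ≡⟨ cong₂ (λ x y → s * (x * det (minor X j)) + t * (s * (y * det (minor Y j))))
           (M≈X zero j j≢c) (M≈Y zero j j≢c) ⟩
    s * (X zero j * det (minor X j)) + t * (s * (Y zero j * det (minor Y j)))  ∎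
    where
    s : ℤ
    s = negOnePow (toℕ j)
    distribute′ : ∀ s m a t b → s * (m * (a + t * b)) ≡ s * (m * a) + t * (s * (m * b))
    distribute′ = solve-∀
    minor-linear : det (minor M j) ≡ det (minor X j) + t * det (minor Y j)
    minor-linear = det-linear (minor M j) (minor X j) (minor Y j) (punchOut j≢c) t
      (λ r k k≢c′ → M≈X (suc r) (punchIn j k) (punchIn-≢-punchOut j≢c k≢c′))
      (λ r k k≢c′ → M≈Y (suc r) (punchIn j k) (punchIn-≢-punchOut j≢c k≢c′))
      (λ r → subst (λ l → M (suc r) l ≡ X (suc r) l + t * Y (suc r) l)
                   (sym (Finₚ.punchIn-punchOut j≢c)) (Mc≡ (suc r)))

punchIn-adjacent : ∀ {n} (j k : Fin (suc n)) (c : Fin n) → toℕ k ≡ suc (toℕ j) →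
  punchIn j c ≡ punchIn k c ⊎ (punchIn j c ≡ k × punchIn k c ≡ j)
punchIn-adjacent zero    (suc zero)    zero    _ = inj₂ (refl , refl)
punchIn-adjacent zero    (suc zero)    (suc c) _ = inj₁ refl
punchIn-adjacent zero    (suc (suc k)) c       ()
punchIn-adjacent (suc j) zero          c       ()
punchIn-adjacent (suc j) (suc k)       zero    _ = inj₁ refl
punchIn-adjacent (suc j) (suc k)       (suc c) k≡1+j
  with punchIn-adjacent j k c (ℕₚ.suc-injective k≡1+j)
... | inj₁ same            = inj₁ (cong suc same)
... | inj₂ (j′≡k , k′≡j) = inj₂ (cong suc j′≡k , cong suc k′≡j)

punchOut-adjacent : ∀ {n} {l j k : Fin (suc n)} (l≢j : l ≢ j) (l≢k : l ≢ k) →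
  toℕ k ≡ suc (toℕ j) → toℕ (punchOut l≢k) ≡ suc (toℕ (punchOut l≢j))
punchOut-adjacent {_}           {zero}        {zero}  {_}           l≢j _   _ = ⊥-elim (l≢j refl)
punchOut-adjacent {_}           {zero}        {suc j} {zero}        _   _   ()
punchOut-adjacent {_}           {zero}        {suc j} {suc k}       _   _   k≡1+j = ℕₚ.suc-injective k≡1+j
punchOut-adjacent {_}           {suc l}       {zero}  {zero}        _   _   ()
punchOut-adjacent {_}           {suc zero}    {zero}  {suc zero}    _   l≢k _ = ⊥-elim (l≢k refl)
punchOut-adjacent {suc (suc n)} {suc (suc l)} {zero}  {suc zero}    _   _   _ = refl
punchOut-adjacent {_}           {suc l}       {zero}  {suc (suc k)} _   _   ()
punchOut-adjacent {_}           {suc l}       {suc j} {zero}        _   _   ()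
punchOut-adjacent {suc n}       {suc l}       {suc j} {suc k}       l≢j l≢k k≡1+j =
  cong suc (punchOut-adjacent (l≢j ∘ cong suc) (l≢k ∘ cong suc) (ℕₚ.suc-injective k≡1+j))

det-adjacent-equal-columns : ∀ {n} (M : Matrix n) {j k : Fin n} → toℕ k ≡ suc (toℕ j) →
  (∀ i → M i j ≡ M i k) → det M ≡ 0ℤ
det-adjacent-equal-columns {suc n} M {j} {k} k≡1+j Mj≡Mk = begin
  det M                                  ≡⟨ Σᶠ-pair (laplaceTerm M) j≢k other-terms-vanish ⟩
  laplaceTerm M j + laplaceTerm M k
    ≡⟨ cong (λ s → laplaceTerm M j + s * (M zero k * det (minor M k))) (cong negOnePow k≡1+j) ⟩
  s * (M zero j * d) + (- s) * (M zero k * det (minor M k))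
    ≡⟨ cong₂ (λ m d′ → s * (M zero j * d) + (- s) * (m * d′)) (sym (Mj≡Mk zero)) (sym (det-cong minors-equal)) ⟩
  s * (M zero j * d) + (- s) * (M zero j * d)   ≡⟨ cancel s (M zero j * d) ⟩
  0ℤ                                     ∎
  where
  s d : ℤ
  s = negOnePow (toℕ j)
  d = det (minor M j)
  cancel : ∀ s x → s * x + (- s) * x ≡ 0ℤ
  cancel = solve-∀
  j≢k : j ≢ k
  j≢k refl = ℕₚ.1+n≢n (sym k≡1+j)
  other-terms-vanish : ∀ l → l ≢ j → l ≢ k → laplaceTerm M l ≡ 0ℤ
  other-terms-vanish l l≢j l≢k = laplaceTerm-zero-minor M l
    (det-adjacent-equal-columns (minor M l) (punchOut-adjacent l≢j l≢k k≡1+j) λ r → begin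
      M (suc r) (punchIn l (punchOut l≢j))  ≡⟨ cong (M (suc r)) (Finₚ.punchIn-punchOut l≢j) ⟩
      M (suc r) j                           ≡⟨ Mj≡Mk (suc r) ⟩
      M (suc r) k                           ≡⟨ cong (M (suc r)) (Finₚ.punchIn-punchOut l≢k) ⟨
      M (suc r) (punchIn l (punchOut l≢k))  ∎)
  minors-equal : ∀ r c → minor M j r c ≡ minor M k r c
  minors-equal r c with punchIn-adjacent j k c k≡1+j
  ... | inj₁ same           = cong (M (suc r)) same
  ... | inj₂ (j′≡k , k′≡j) = begin
    M (suc r) (punchIn j c)  ≡⟨ cong (M (suc r)) j′≡k ⟩
    M (suc r) k              ≡⟨ Mj≡Mk (suc r) ⟨
    M (suc r) j              ≡⟨ cong (M (suc r)) k′≡j ⟨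
    M (suc r) (punchIn k c)  ∎

module TwoColumns {n} (M : Matrix n) {j k : Fin n} (j≢k : j ≢ k) where

  M[_,_] : (Fin n → ℤ) → (Fin n → ℤ) → Matrix n
  M[ x , y ] = withColumn k y (withColumn j x M)

  M[,]-j : ∀ x y i → M[ x , y ] i j ≡ x i
  M[,]-j x y i = trans (withColumn-≢ y _ i j≢k) (withColumn-≡ j x M i)

  M[,]-k : ∀ x y i → M[ x , y ] i k ≡ y i
  M[,]-k x y i = withColumn-≡ k y _ i

  M[,]-other : ∀ x y i {l} → l ≢ j → l ≢ k → M[ x , y ] i l ≡ M i l
  M[,]-other x y i l≢j l≢k = trans (withColumn-≢ y _ i l≢k) (withColumn-≢ x M i l≢j)

  M[,]-self : ∀ i l → M[ (λ r → M r j) , (λ r → M r k) ] i l ≡ M i l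
  M[,]-self i l = trans (withColumn-cong k _ i l (withColumn-self j M i l)) (withColumn-self k M i l)

  additive-j : ∀ x x′ y → det M[ (λ i → x i + x′ i) , y ] ≡ det M[ x , y ] + det M[ x′ , y ]
  additive-j x x′ y = trans
    (det-linear M[ x+x′ , y ] M[ x , y ] M[ x′ , y ] j 1ℤ (off-j x) (off-j x′) λ i → begin
      M[ x+x′ , y ] i j         ≡⟨ M[,]-j x+x′ y i ⟩
      x i + x′ i                ≡⟨ cong (_+_ (x i)) (ℤₚ.*-identityˡ (x′ i)) ⟨
      x i + 1ℤ * x′ i           ≡⟨ cong₂ (λ a b → a + 1ℤ * b) (M[,]-j x y i) (M[,]-j x′ y i) ⟨
      M[ x , y ] i j + 1ℤ * M[ x′ , y ] i j  ∎)
    (cong (_+_ (det M[ x , y ])) (ℤₚ.*-identityˡ _))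
    where
    x+x′ : Fin n → ℤ
    x+x′ i = x i + x′ i
    off-j : ∀ z i l → l ≢ j → M[ x+x′ , y ] i l ≡ M[ z , y ] i l
    off-j z i l l≢j = withColumn-cong k y i l (trans (withColumn-≢ x+x′ M i l≢j) (sym (withColumn-≢ z M i l≢j)))

  additive-k : ∀ x y y′ → det M[ x , (λ i → y i + y′ i) ] ≡ det M[ x , y ] + det M[ x , y′ ]
  additive-k x y y′ = trans
    (det-linear M[ x , y+y′ ] M[ x , y ] M[ x , y′ ] k 1ℤ (off-k y) (off-k y′) λ i → begin
      M[ x , y+y′ ] i k         ≡⟨ M[,]-k x y+y′ i ⟩
      y i + y′ i                ≡⟨ cong (_+_ (y i)) (ℤₚ.*-identityˡ (y′ i)) ⟨
      y i + 1ℤ * y′ i           ≡⟨ cong₂ (λ a b → a + 1ℤ * b) (M[,]-k x y i) (M[,]-k x y′ i) ⟨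
      M[ x , y ] i k + 1ℤ * M[ x , y′ ] i k  ∎)
    (cong (_+_ (det M[ x , y ])) (ℤₚ.*-identityˡ _))
    where
    y+y′ : Fin n → ℤ
    y+y′ i = y i + y′ i
    off-k : ∀ z i l → l ≢ k → M[ x , y+y′ ] i l ≡ M[ x , z ] i l
    off-k z i l l≢k = trans (withColumn-≢ y+y′ _ i l≢k) (sym (withColumn-≢ z _ i l≢k))

  antisymmetric : toℕ k ≡ suc (toℕ j) → ∀ x y → det M[ x , y ] + det M[ y , x ] ≡ 0ℤ
  antisymmetric k≡1+j x y = begin
    det M[ x , y ] + det M[ y , x ]
      ≡⟨ cong₂ _+_ (ℤₚ.+-identityˡ (det M[ x , y ])) (ℤₚ.+-identityʳ (det M[ y , x ])) ⟨
    (0ℤ + det M[ x , y ]) + (det M[ y , x ] + 0ℤ)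
      ≡⟨ cong₂ (λ a b → (a + det M[ x , y ]) + (det M[ y , x ] + b)) (alternating x) (alternating y) ⟨
    (det M[ x , x ] + det M[ x , y ]) + (det M[ y , x ] + det M[ y , y ])
      ≡⟨ cong₂ _+_ (additive-k x x y) (additive-k y x y) ⟨
    det M[ x , s ] + det M[ y , s ]  ≡⟨ additive-j x y s ⟨
    det M[ s , s ]                   ≡⟨ alternating s ⟩
    0ℤ                               ∎
    where
    s : Fin n → ℤ
    s i = x i + y i
    alternating : ∀ z → det M[ z , z ] ≡ 0ℤ
    alternating z = det-adjacent-equal-columns M[ z , z ] k≡1+j λ i → trans (M[,]-j z z i) (sym (M[,]-k z z i))

-- Swap column k with its left neighbour k′: by antisymmetry this negates det M, and in the swapped
-- matrix the equal columns j and k′ are one step closer.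
det-equal-columns-apart : ∀ d {n} (M : Matrix n) {j k : Fin n} → toℕ k ≡ suc (d ℕ.+ toℕ j) →
  (∀ i → M i j ≡ M i k) → det M ≡ 0ℤ
det-equal-columns-apart zero    M k≡1+j Mj≡Mk = det-adjacent-equal-columns M k≡1+j Mj≡Mk
det-equal-columns-apart (suc d) {n} M {j} {k} k≡2+d+j Mj≡Mk = begin
  det M                                      ≡⟨ det-cong M[,]-self ⟨
  det M[ Mk′ , Mk ]                          ≡⟨ ℤₚ.+-identityʳ _ ⟨
  det M[ Mk′ , Mk ] + 0ℤ                     ≡⟨ cong (_+_ (det M[ Mk′ , Mk ])) swapped-vanishes ⟨
  det M[ Mk′ , Mk ] + det M[ Mk , Mk′ ]      ≡⟨ antisymmetric k≡1+k′ Mk′ Mk ⟩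
  0ℤ                                         ∎
  where
  k′<n : suc (d ℕ.+ toℕ j) ℕ.< n
  k′<n = ℕₚ.<-trans (ℕₚ.n<1+n _) (subst (ℕ._< n) k≡2+d+j (Finₚ.toℕ<n k))
  k′ : Fin n
  k′ = fromℕ< k′<n
  k′≡1+d+j : toℕ k′ ≡ suc (d ℕ.+ toℕ j)
  k′≡1+d+j = Finₚ.toℕ-fromℕ< k′<n
  k≡1+k′ : toℕ k ≡ suc (toℕ k′)
  k≡1+k′ = trans k≡2+d+j (cong suc (sym k′≡1+d+j))
  k′≢k : k′ ≢ k
  k′≢k k′≡k = ℕₚ.1+n≢n (trans (sym k≡1+k′) (cong toℕ (sym k′≡k)))
  j<k′ : toℕ j ℕ.< toℕ k′
  j<k′ = subst (toℕ j ℕ.<_) (sym k′≡1+d+j) (ℕ.s≤s (ℕₚ.m≤n+m (toℕ j) d))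
  j<k : toℕ j ℕ.< toℕ k
  j<k = ℕₚ.<-trans j<k′ (subst (toℕ k′ ℕ.<_) (sym k≡1+k′) (ℕₚ.n<1+n _))
  open TwoColumns M k′≢k
  Mk Mk′ : Fin n → ℤ
  Mk i = M i k
  Mk′ i = M i k′
  swapped-vanishes : det M[ Mk , Mk′ ] ≡ 0ℤ
  swapped-vanishes = det-equal-columns-apart d M[ Mk , Mk′ ] k′≡1+d+j λ i →
    trans (M[,]-other Mk Mk′ i (λ j≡k′ → ℕₚ.<-irrefl (cong toℕ j≡k′) j<k′)
                                (λ j≡k → ℕₚ.<-irrefl (cong toℕ j≡k) j<k))
          (trans (Mj≡Mk i) (sym (M[,]-j Mk Mk′ i)))

det-equal-columns : ∀ {n} (M : Matrix n) {j k : Fin n} → j ≢ k → (∀ i → M i j ≡ M i k) → det M ≡ 0ℤ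
det-equal-columns M {j} {k} j≢k Mj≡Mk with ℕₚ.<-cmp (toℕ j) (toℕ k)
... | tri< j<k _ _ = det-equal-columns-apart _ M (trans (sym (ℕₚ.m∸n+n≡m j<k)) (ℕₚ.+-suc _ (toℕ j))) Mj≡Mk
... | tri≈ _ j≡k _ = ⊥-elim (j≢k (Finₚ.toℕ-injective j≡k))
... | tri> _ _ k<j = det-equal-columns-apart _ M (trans (sym (ℕₚ.m∸n+n≡m k<j)) (ℕₚ.+-suc _ (toℕ k))) (sym ∘ Mj≡Mk)

det-add-column-multiple : ∀ {n} (M : Matrix n) {a c} → a ≢ c → ∀ t →
  det (withColumn c (λ i → M i c + t * M i a) M) ≡ det M
det-add-column-multiple M {a} {c} a≢c t = begin
  det (withColumn c _ M)   ≡⟨ det-linear _ M Ma-at-c c t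
                                (λ i l l≢c → withColumn-≢ _ M i l≢c)
                                (λ i l l≢c → trans (withColumn-≢ _ M i l≢c) (sym (withColumn-≢ _ M i l≢c)))
                                (λ i → trans (withColumn-≡ c _ M i)
                                             (cong (λ y → M i c + t * y) (sym (withColumn-≡ c _ M i)))) ⟩
  det M + t * det Ma-at-c  ≡⟨ cong (λ d → det M + t * d) (det-equal-columns Ma-at-c a≢c λ i →
                                trans (withColumn-≢ _ M i a≢c) (sym (withColumn-≡ c _ M i))) ⟩
  det M + t * 0ℤ           ≡⟨ cong (_+_ (det M)) (ℤₚ.*-zeroʳ t) ⟩
  det M + 0ℤ               ≡⟨ ℤₚ.+-identityʳ (det M) ⟩
  det M                    ∎
  where
  Ma-at-c : Matrix _
  Ma-at-c = withColumn c (λ i → M i a) M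

-- Counting, and the sign of a permutation

χ : ∀ {p} {P : Set p} → Dec P → ℕ
χ P? = if does P? then 1 else 0

χ-⇔ : ∀ {p q} {P : Set p} {Q : Set q} → (P → Q) → (Q → P) → (P? : Dec P) (Q? : Dec Q) → χ P? ≡ χ Q?
χ-⇔ P→Q Q→P P? Q? = cong (λ b → if b then 1 else 0) (does-⇔ (mk⇔ P→Q Q→P) P? Q?)

χ-yes : ∀ {p} {P : Set p} (P? : Dec P) → P → χ P? ≡ 1
χ-yes P? p rewrite dec-true P? p = refl

χ-no : ∀ {p} {P : Set p} (P? : Dec P) → ¬ P → χ P? ≡ 0
χ-no P? ¬p rewrite dec-false P? ¬p = refl

χ-≟true : ∀ b → χ (b Bool.≟ true) ≡ (if b then 1 else 0)
χ-≟true true       = refl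
χ-≟true false = refl

count : ∀ {n p} {P : Pred (Fin n) p} → Decidable P → ℕ
count P? = ℕΣ.sum (χ ∘ P?)

count-⇔ : ∀ {n p q} {P : Pred (Fin n) p} {Q : Pred (Fin n) q} (P? : Decidable P) (Q? : Decidable Q) →
  (∀ i → P i → Q i) → (∀ i → Q i → P i) → count P? ≡ count Q?
count-⇔ P? Q? P⊆Q Q⊆P = ℕΣ.sum-cong-≗ (λ i → χ-⇔ (P⊆Q i) (Q⊆P i) (P? i) (Q? i))

count-remove : ∀ {n p} {P : Pred (Fin (suc n)) p} (P? : Decidable P) a → count P? ≡ χ (P? a) ℕ.+ count (P? ∘ punchIn a)
count-remove P? a = ℕΣ.sum-remove (χ ∘ P?)

count-permute : ∀ {n p} {P : Pred (Fin n) p} (P? : Decidable P) (π : Permutation′ n) → count (P? ∘ (π ⟨$⟩ʳ_)) ≡ count P?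
count-permute P? π = sym (ℕΣ.sum-permute (χ ∘ P?) π)

count-≡ : ∀ {n} (m : Fin n) → count (_≟ m) ≡ 1
count-≡ {suc n} zero    = cong suc (ℕΣ.sum-replicate-zero n)
count-≡ {suc n} (suc m) = count-≡ m

count-< : ∀ {n} m → m ℕ.≤ n → count {n} (λ y → toℕ y <? m) ≡ m
count-< {n}     zero    _           = ℕΣ.sum-replicate-zero n
count-< {suc n} (suc m) (ℕ.s≤s m≤n) = cong suc (count-< m m≤n)

count-image : ∀ {L N} (g : Fin L → Fin N) → Injective _≡_ _≡_ g →
  count (λ j → Finₚ.any? (λ m → g m ≟ j)) ≡ L
count-image {zero}  {N} g _ = ℕΣ.sum-replicate-zero N
count-image {suc L} {N} g g-inj = begin
  count (λ j → Finₚ.any? (λ m → g m ≟ j))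
    ≡⟨ ℕΣ.sum-cong-≗ split ⟩
  ℕΣ.sum (λ j → χ (g zero ≟ j) ℕ.+ χ (Finₚ.any? (λ m → g (suc m) ≟ j)))
    ≡⟨ ℕΣ.∑-distrib-+ (λ j → χ (g zero ≟ j)) _ ⟩
  count (g zero ≟_) ℕ.+ count (λ j → Finₚ.any? (λ m → g (suc m) ≟ j))
    ≡⟨ cong₂ ℕ._+_ (trans (count-⇔ (g zero ≟_) (_≟ g zero) (λ _ → sym) (λ _ → sym)) (count-≡ (g zero)))
                   (count-image (g ∘ suc) (Finₚ.suc-injective ∘ g-inj)) ⟩
  suc L  ∎
  where
  split : ∀ j → χ (Finₚ.any? (λ m → g m ≟ j)) ≡ χ (g zero ≟ j) ℕ.+ χ (Finₚ.any? (λ m → g (suc m) ≟ j))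
  split j with g zero ≟ j | Finₚ.any? (λ m → g (suc m) ≟ j)
  ... | yes g₀≡j | yes (m , gm≡j) = ⊥-elim (Finₚ.0≢1+n (g-inj (trans g₀≡j (sym gm≡j))))
  ... | yes _    | no  _          = refl
  ... | no  _    | yes _          = refl
  ... | no  _    | no  _          = refl

length-filter : ∀ {a p} {A : Set a} {P : Pred A p} (P? : Decidable P) xs →
  length (filter P? xs) ≡ sum (List.map (χ ∘ P?) xs)
length-filter P? []       = refl
length-filter P? (x ∷ xs) with P? x
... | yes _ = cong suc (length-filter P? xs)
... | no  _ = length-filter P? xs

length-filter-filter : ∀ {a p q} {A : Set a} {P : Pred A p} {Q : Pred A q} (P? : Decidable P) (Q? : Decidable Q) xs →
  length (filter Q? (filter P? xs)) ≡ sum (List.map (λ x → χ (P? x ×-dec Q? x)) xs)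
length-filter-filter P? Q? [] = refl
length-filter-filter P? Q? (x ∷ xs) with P? x
... | no  _ = length-filter-filter P? Q? xs
... | yes _ with Q? x
...   | no  _ = length-filter-filter P? Q? xs
...   | yes _ = cong suc (length-filter-filter P? Q? xs)

sum-map-concatMap : ∀ {a b} {A : Set a} {B : Set b} (h : B → ℕ) (g : A → List B) xs →
  sum (List.map h (concatMap g xs)) ≡ sum (List.map (sum ∘ List.map h ∘ g) xs)
sum-map-concatMap h g []       = refl
sum-map-concatMap h g (x ∷ xs) = begin
  sum (List.map h (g x ++ concatMap g xs))
    ≡⟨ cong sum (Listₚ.map-++ h (g x) (concatMap g xs)) ⟩
  sum (List.map h (g x) ++ List.map h (concatMap g xs))
    ≡⟨ ListActionₚ.sum-++ (List.map h (g x)) _ ⟩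
  sum (List.map h (g x)) ℕ.+ sum (List.map h (concatMap g xs))
    ≡⟨ cong (ℕ._+_ (sum (List.map h (g x)))) (sum-map-concatMap h g xs) ⟩
  sum (List.map (sum ∘ List.map h ∘ g) (x ∷ xs))  ∎

sum-map-tabulate : ∀ {a} {A : Set a} {n} (h : A → ℕ) (f : Fin n → A) →
  sum (List.map h (tabulate f)) ≡ ℕΣ.sum (h ∘ f)
sum-map-tabulate {n = zero}  h f = refl
sum-map-tabulate {n = suc n} h f = cong (ℕ._+_ (h (f zero))) (sum-map-tabulate h (f ∘ suc))

Inversion? : ∀ {n} (σ : Permutation′ n) i j → Dec (toℕ i ℕ.< toℕ j × toℕ (σ ⟨$⟩ʳ j) ℕ.< toℕ (σ ⟨$⟩ʳ i))
Inversion? σ i j = (toℕ i <? toℕ j) ×-dec (toℕ (σ ⟨$⟩ʳ j) <? toℕ (σ ⟨$⟩ʳ i))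

inversionCount : ∀ {n} → Permutation′ n → ℕ
inversionCount {n} σ = ∑[ i < n ] count (Inversion? σ i)

inversions≡inversionCount : ∀ {n} (σ : Permutation′ n) → inversions σ ≡ inversionCount σ
inversions≡inversionCount {n} σ = begin
  inversions σ
    ≡⟨ length-filter-filter _ _ (concatMap row (allFin n)) ⟩
  sum (List.map h (concatMap row (allFin n)))
    ≡⟨ sum-map-concatMap h row (allFin n) ⟩
  sum (List.map (sum ∘ List.map h ∘ row) (allFin n))
    ≡⟨ sum-map-tabulate (sum ∘ List.map h ∘ row) (λ i → i) ⟩
  ∑[ i < n ] sum (List.map h (row i))
    ≡⟨ ℕΣ.sum-cong-≗ (λ i → trans (cong sum (sym (Listₚ.map-∘ (allFin n))))
                                   (sum-map-tabulate (h ∘ (i ,_)) (λ j → j))) ⟩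
  ∑[ i < n ] count (Inversion? σ i)  ∎
  where
  row : Fin n → List (Fin n × Fin n)
  row i = List.map (i ,_) (allFin n)
  h : Fin n × Fin n → ℕ
  h (i , j) = χ (Inversion? σ i j)

<pivot⇒punchIn<pivot : ∀ {n} (a : Fin (suc n)) y → toℕ y ℕ.< toℕ a → toℕ (punchIn a y) ℕ.< toℕ a
<pivot⇒punchIn<pivot (suc a) zero    _             = ℕ.s≤s ℕ.z≤n
<pivot⇒punchIn<pivot (suc a) (suc y) (ℕ.s≤s y<a) = ℕ.s≤s (<pivot⇒punchIn<pivot a y y<a)

punchIn<pivot⇒<pivot : ∀ {n} (a : Fin (suc n)) y → toℕ (punchIn a y) ℕ.< toℕ a → toℕ y ℕ.< toℕ a
punchIn<pivot⇒<pivot (suc a) zero    _             = ℕ.s≤s ℕ.z≤n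
punchIn<pivot⇒<pivot (suc a) (suc y) (ℕ.s≤s y<a) = ℕ.s≤s (punchIn<pivot⇒<pivot a y y<a)

punchIn-mono-< : ∀ {n} (a : Fin (suc n)) p q → toℕ p ℕ.< toℕ q → toℕ (punchIn a p) ℕ.< toℕ (punchIn a q)
punchIn-mono-< a p q p<q = ℕₚ.≰⇒> λ q′≤p′ → ℕₚ.<⇒≱ p<q (Finₚ.punchIn-cancel-≤ a q p q′≤p′)

punchIn-cancel-< : ∀ {n} (a : Fin (suc n)) p q → toℕ (punchIn a p) ℕ.< toℕ (punchIn a q) → toℕ p ℕ.< toℕ q
punchIn-cancel-< a p q p′<q′ = ℕₚ.≰⇒> λ q≤p → ℕₚ.<⇒≱ p′<q′ (Finₚ.punchIn-mono-≤ a q p q≤p)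

inversionCount-remove-zero : ∀ {n} (σ : Permutation′ (suc n)) →
  inversionCount σ ≡ toℕ (σ ⟨$⟩ʳ zero) ℕ.+ inversionCount (remove zero σ)
inversionCount-remove-zero {n} σ = cong₂ ℕ._+_ first-row (ℕΣ.sum-cong-≗ other-row)
  where
  a : Fin (suc n)
  a = σ ⟨$⟩ʳ zero
  σ′ : Permutation′ n
  σ′ = remove zero σ
  σ-suc : ∀ j → σ ⟨$⟩ʳ suc j ≡ punchIn a (σ′ ⟨$⟩ʳ j)
  σ-suc = Perm.punchIn-permute σ zero
  first-row : count (Inversion? σ zero) ≡ toℕ a
  first-row = begin
    count (λ j → toℕ (σ ⟨$⟩ʳ suc j) <? toℕ a)
      ≡⟨ count-⇔ (λ j → toℕ (σ ⟨$⟩ʳ suc j) <? toℕ a) (λ j → toℕ (σ′ ⟨$⟩ʳ j) <? toℕ a)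
           (λ j lt → punchIn<pivot⇒<pivot a _ (subst (λ x → toℕ x ℕ.< toℕ a) (σ-suc j) lt))
           (λ j lt → subst (λ x → toℕ x ℕ.< toℕ a) (sym (σ-suc j)) (<pivot⇒punchIn<pivot a _ lt)) ⟩
    count (λ j → toℕ (σ′ ⟨$⟩ʳ j) <? toℕ a)  ≡⟨ count-permute {n} (λ y → toℕ y <? toℕ a) σ′ ⟩
    count {n} (λ y → toℕ y <? toℕ a)        ≡⟨ count-< (toℕ a) (ℕₚ.≤-pred (Finₚ.toℕ<n a)) ⟩
    toℕ a                                   ∎
  other-row : ∀ i → count (Inversion? σ (suc i)) ≡ count (Inversion? σ′ i)
  other-row i = count-⇔ (λ j → Inversion? σ (suc i) (suc j)) (Inversion? σ′ i)
    (λ j (i<j , σj<σi) → ℕ.s<s⁻¹ i<j ,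
      punchIn-cancel-< a _ _ (subst₂ (λ x y → toℕ x ℕ.< toℕ y) (σ-suc j) (σ-suc i) σj<σi))
    (λ j (i<j , σj<σi) → ℕ.s<s i<j ,
      subst₂ (λ x y → toℕ x ℕ.< toℕ y) (sym (σ-suc j)) (sym (σ-suc i)) (punchIn-mono-< a _ _ σj<σi))

negOnePow-+ : ∀ m n → negOnePow (m ℕ.+ n) ≡ negOnePow m * negOnePow n
negOnePow-+ zero    n = sym (ℤₚ.*-identityˡ (negOnePow n))
negOnePow-+ (suc m) n = trans (cong -_ (negOnePow-+ m n)) (ℤₚ.neg-distribˡ-* (negOnePow m) (negOnePow n))

sign-remove-zero : ∀ {n} (σ : Permutation′ (suc n)) → sign σ ≡ negOnePow (toℕ (σ ⟨$⟩ʳ zero)) * sign (remove zero σ)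
sign-remove-zero {n} σ = begin
  negOnePow (inversions σ)                          ≡⟨ cong negOnePow (inversions≡inversionCount σ) ⟩
  negOnePow (inversionCount σ)                      ≡⟨ cong negOnePow (inversionCount-remove-zero σ) ⟩
  negOnePow (toℕ a ℕ.+ inversionCount σ′)
    ≡⟨ cong (λ k → negOnePow (toℕ a ℕ.+ k)) (inversions≡inversionCount σ′) ⟨
  negOnePow (toℕ a ℕ.+ inversions σ′)               ≡⟨ negOnePow-+ (toℕ a) (inversions σ′) ⟩
  negOnePow (toℕ a) * negOnePow (inversions σ′)     ∎
  where
  a : Fin (suc n)
  a = σ ⟨$⟩ʳ zero
  σ′ : Permutation′ n
  σ′ = remove zero σ

-- Cycles of an injective map

negOnePow-∑ : ∀ {n} (h : Fin n → ℕ) → ∏ (negOnePow ∘ h) ≡ negOnePow (ℕΣ.sum h)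
negOnePow-∑ {zero}  h = refl
negOnePow-∑ {suc n} h = trans (cong (negOnePow (h zero) *_) (negOnePow-∑ (h ∘ suc))) (sym (negOnePow-+ (h zero) _))

negOnePow-2+ : ∀ k → negOnePow (2 ℕ.+ k) ≡ negOnePow k
negOnePow-2+ k = ℤₚ.neg-involutive (negOnePow k)

negOnePow≡1⇒even : ∀ k → negOnePow k ≡ 1ℤ → 2 ∣ k
negOnePow≡1⇒even zero          _    = 2 ∣0
negOnePow≡1⇒even (suc zero)    ()
negOnePow≡1⇒even (suc (suc k)) even = ∣m∣n⇒∣m+n ∣-refl (negOnePow≡1⇒even k (trans (sym (negOnePow-2+ k)) even))

even⇒negOnePow≡1 : ∀ k → 2 ∣ k → negOnePow k ≡ 1ℤ
even⇒negOnePow≡1 zero          _      = refl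
even⇒negOnePow≡1 (suc zero)    2∣1    with () ← ∣1⇒≡1 2∣1
even⇒negOnePow≡1 (suc (suc k)) 2∣2+k = trans (negOnePow-2+ k) (even⇒negOnePow≡1 k (∣m+n∣m⇒∣n 2∣2+k ∣-refl))

∏-scale-at : ∀ {n} (g g′ : Fin n → ℤ) i c → (∀ z → z ≢ i → g′ z ≡ g z) → g′ i ≡ c * g i →
  ∏ g′ ≡ c * ∏ g
∏-scale-at {suc n} g g′ i c away at-i = begin
  ∏ g′                           ≡⟨ ℤΠ.sum-remove {i = i} g′ ⟩
  g′ i * ∏ (g′ ∘ punchIn i)
    ≡⟨ cong₂ _*_ at-i (ℤΠ.sum-cong-≗ λ z → away (punchIn i z) (Finₚ.punchInᵢ≢i i z)) ⟩
  (c * g i) * ∏ (g ∘ punchIn i)  ≡⟨ ℤₚ.*-assoc c (g i) _ ⟩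
  c * (g i * ∏ (g ∘ punchIn i))  ≡⟨ cong (c *_) (ℤΠ.sum-remove {i = i} g) ⟨
  c * ∏ g                        ∎

least-witness : ∀ {p} {P : Pred ℕ p} → Decidable P → ∀ {n} → P n → ∃[ m ] (P m × (∀ {k} → k ℕ.< m → ¬ P k))
least-witness {P = P} P? {n} Pn = go n Pn (<-wellFounded n)
  where
  go : ∀ n → P n → Acc ℕ._<_ n → ∃[ m ] (P m × (∀ {k} → k ℕ.< m → ¬ P k))
  go n Pn (acc smaller) with ℕₚ.anyUpTo? P? n
  ... | yes (m , m<n , Pm) = go m Pm (smaller m<n)
  ... | no  none           = n , Pn , λ k<n Pk → none (_ , k<n , Pk)

min-witness : ∀ {n p} {P : Pred (Fin n) p} → Decidable P → ∀ {z} → P z →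
  ∃[ m ] (P m × (∀ y → P y → toℕ m ℕ.≤ toℕ y))
min-witness {suc n} P? {z} Pz with P? zero
... | yes P0 = zero , P0 , λ _ _ → ℕ.z≤n
min-witness {suc n} P? {zero}  Pz | no ¬P0 = ⊥-elim (¬P0 Pz)
min-witness {suc n} P? {suc z} Pz | no ¬P0 with min-witness (P? ∘ suc) Pz
... | m , Pm , least = suc m , Pm , λ where
  zero    P0 → ⊥-elim (¬P0 P0)
  (suc y) Py → ℕ.s≤s (least y Py)

iter-+ : ∀ {n} (f : Fin n → Fin n) m k i → iter f (m ℕ.+ k) i ≡ iter f m (iter f k i)
iter-+ f zero    k i = refl
iter-+ f (suc m) k i = cong f (iter-+ f m k i)

iter-sucʳ : ∀ {n} (f : Fin n → Fin n) k i → iter f k (f i) ≡ iter f (suc k) i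
iter-sucʳ f k i = trans (sym (iter-+ f k 1 i)) (cong (λ m → iter f m i) (ℕₚ.+-comm k 1))

iter-multiple : ∀ {n} (f : Fin n → Fin n) {p i} → iter f p i ≡ i → ∀ q → iter f (q ℕ.* p) i ≡ i
iter-multiple f         per zero    = refl
iter-multiple f {p} {i} per (suc q) = trans (iter-+ f p (q ℕ.* p) i) (trans (cong (iter f p) (iter-multiple f per q)) per)

iter-mod : ∀ {n} (f : Fin n → Fin n) {p i} → iter f (suc p) i ≡ i → ∀ k → iter f (k % suc p) i ≡ iter f k i
iter-mod f {p} {i} per k = begin
  iter f (k % suc p) i                                       ≡⟨ cong (iter f (k % suc p)) (iter-multiple f per (k / suc p)) ⟨
  iter f (k % suc p) (iter f ((k / suc p) ℕ.* suc p) i)      ≡⟨ iter-+ f (k % suc p) _ i ⟨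
  iter f (k % suc p ℕ.+ (k / suc p) ℕ.* suc p) i             ≡⟨ cong (λ m → iter f m i) (m≡m%n+[m/n]*n k (suc p)) ⟨
  iter f k i                                                 ∎

cycleFactor : ∀ {p} {P : Set p} → Dec P → ℤ → ℤ
cycleFactor P? x = if does P? then - x else 1ℤ

cycleFactor-yes : ∀ {p} {P : Set p} (P? : Dec P) x → P → cycleFactor P? x ≡ - x
cycleFactor-yes P? x p rewrite dec-true P? p = refl

cycleFactor-no : ∀ {p} {P : Set p} (P? : Dec P) x → ¬ P → cycleFactor P? x ≡ 1ℤ
cycleFactor-no P? x ¬p rewrite dec-false P? ¬p = refl

cycleFactor-⇔ : ∀ {p q} {P : Set p} {Q : Set q} (P? : Dec P) (Q? : Dec Q) x → (P → Q) → (Q → P) →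
  cycleFactor P? x ≡ cycleFactor Q? x
cycleFactor-⇔ P? Q? x P→Q Q→P = cong (λ b → if b then - x else 1ℤ) (does-⇔ (mk⇔ P→Q Q→P) P? Q?)

cycleFactor-1 : ∀ {p} {P : Set p} (P? : Dec P) → cycleFactor P? 1ℤ ≡ negOnePow (χ P?)
cycleFactor-1 P? with does P?
... | true  = refl
... | false = refl

module Cycles {N} (f : Fin N → Fin N) (f-injective : Injective _≡_ _≡_ f) where

  iter-injective : ∀ k {x y} → iter f k x ≡ iter f k y → x ≡ y
  iter-injective zero    eq = eq
  iter-injective (suc k) eq = iter-injective k (f-injective eq)

  -- Two of the first N + 1 iterates of i coincide, and injectivity cancels the common prefix.
  period : ∀ i → ∃[ p ] (suc p ℕ.≤ N × iter f (suc p) i ≡ i)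
  period i with Finₚ.pigeonhole (ℕₚ.n<1+n N) (λ (k : Fin (suc N)) → iter f (toℕ k) i)
  ... | k₁ , k₂ , k₁<k₂ , same = p , 1+p≤N , iter-injective (toℕ k₁) (begin
    iter f (toℕ k₁) (iter f (suc p) i)  ≡⟨ iter-+ f (toℕ k₁) (suc p) i ⟨
    iter f (toℕ k₁ ℕ.+ suc p) i         ≡⟨ cong (λ m → iter f m i) k₁+1+p≡k₂ ⟩
    iter f (toℕ k₂) i                   ≡⟨ same ⟨
    iter f (toℕ k₁) i                   ∎)
    where
    p : ℕ
    p = toℕ k₂ ℕ.∸ suc (toℕ k₁)
    k₁+1+p≡k₂ : toℕ k₁ ℕ.+ suc p ≡ toℕ k₂
    k₁+1+p≡k₂ = trans (ℕₚ.+-suc (toℕ k₁) p) (ℕₚ.m+[n∸m]≡n k₁<k₂)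
    1+p≤N : suc p ℕ.≤ N
    1+p≤N = ℕₚ.≤-trans (ℕₚ.m≤n+m (suc p) (toℕ k₁))
            (ℕₚ.≤-trans (ℕₚ.≤-reflexive k₁+1+p≡k₂) (ℕₚ.≤-pred (Finₚ.toℕ<n k₂)))

  infix 4 _∼_ _∼?_
  _∼_ : Fin N → Fin N → Set
  i ∼ j = ∃[ k ] iter f k i ≡ j

  ∼-refl : ∀ {i} → i ∼ i
  ∼-refl = 0 , refl

  ∼-step : ∀ {i j} → i ∼ j → i ∼ f j
  ∼-step (k , refl) = suc k , refl

  ∼-trans : ∀ {i j l} → i ∼ j → j ∼ l → i ∼ l
  ∼-trans {i} (k , refl) (m , refl) = m ℕ.+ k , iter-+ f m k i

  ∼-sym : ∀ {i j} → i ∼ j → j ∼ i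
  ∼-sym {i} (k , refl) with period i
  ... | p , _ , per = k ℕ.* p , (begin
    iter f (k ℕ.* p) (iter f k i)  ≡⟨ iter-+ f (k ℕ.* p) k i ⟨
    iter f (k ℕ.* p ℕ.+ k) i       ≡⟨ cong (λ m → iter f m i) (trans (ℕₚ.+-comm (k ℕ.* p) k) (sym (ℕₚ.*-suc k p))) ⟩
    iter f (k ℕ.* suc p) i         ≡⟨ iter-multiple f per k ⟩
    i                              ∎)

  ∼-unstep : ∀ {i j} → i ∼ f j → i ∼ j
  ∼-unstep i∼fj = ∼-trans i∼fj (∼-sym (1 , refl))

  ∼-bounded : ∀ {i j} → i ∼ j → ∃[ k ] (k ℕ.< N × iter f k i ≡ j)
  ∼-bounded {i} (k , iterₖ≡j) with period i
  ... | p , 1+p≤N , per = k % suc p , ℕₚ.<-≤-trans (m%n<n k (suc p)) 1+p≤N , trans (iter-mod f per k) iterₖ≡j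

  opaque
    _∼?_ : ∀ i j → Dec (i ∼ j)
    i ∼? j = map′ (λ (k , e) → toℕ k , e) bounded (Finₚ.any? (λ k → iter f (toℕ k) i ≟ j))
      where
      bounded : i ∼ j → Σ (Fin N) λ k → iter f (toℕ k) i ≡ j
      bounded i∼j with ∼-bounded i∼j
      ... | k , k<N , e = fromℕ< k<N , trans (cong (λ m → iter f m i) (Finₚ.toℕ-fromℕ< k<N)) e

  ∼-fixed : ∀ {a j} → f a ≡ a → a ∼ j → j ≡ a
  ∼-fixed fa≡a (zero  , refl) = refl
  ∼-fixed fa≡a (suc k , refl) = trans (cong f (∼-fixed fa≡a (k , refl))) fa≡a

  predecessor : ∀ a → ∃[ u ] f u ≡ a
  predecessor a with period a
  ... | p , _ , per = iter f p a , per

  CycleMinimum : Fin N → Set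
  CycleMinimum i = ∀ j → i ∼ j → toℕ i ℕ.≤ toℕ j

  opaque
    cycleMinimum? : Decidable CycleMinimum
    cycleMinimum? i = Finₚ.all? (λ j → (i ∼? j) →-dec (toℕ i ≤? toℕ j))

  ¬cycleMinimum : ∀ {i} → ¬ CycleMinimum i → ∃[ j ] (i ∼ j × toℕ j ℕ.< toℕ i)
  ¬cycleMinimum {i} ¬min with Finₚ.¬∀⟶∃¬ N _ (λ j → (i ∼? j) →-dec (toℕ i ≤? toℕ j)) ¬min
  ... | j , ¬[i∼j⇒i≤j] with i ∼? j | toℕ i ≤? toℕ j
  ...   | yes i∼j | yes i≤j = ⊥-elim (¬[i∼j⇒i≤j] λ _ → i≤j)
  ...   | yes i∼j | no  i≰j = j , i∼j , ℕₚ.≰⇒> i≰j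
  ...   | no  i≁j | _       = ⊥-elim (¬[i∼j⇒i≤j] (⊥-elim ∘ i≁j))

  cl≡count : cl f ≡ count cycleMinimum?
  cl≡count = begin
    length (filter (λ i → isCycleMin f i Bool.≟ true) (allFin N))
      ≡⟨ length-filter (λ i → isCycleMin f i Bool.≟ true) (allFin N) ⟩
    sum (List.map (λ i → χ (isCycleMin f i Bool.≟ true)) (allFin N))
      ≡⟨ sum-map-tabulate (λ i → χ (isCycleMin f i Bool.≟ true)) (λ i → i) ⟩
    ℕΣ.sum (λ i → χ (isCycleMin f i Bool.≟ true))
      ≡⟨ ℕΣ.sum-cong-≗ (λ i → trans (χ-≟true (isCycleMin f i))
                                     (χ-⇔ (listed⇒min i) (min⇒listed i) (listed? i) (cycleMinimum? i))) ⟩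
    count cycleMinimum?  ∎
    where
    Listed : Fin N → Set
    Listed i = All.All (λ k → toℕ i ℕ.≤ toℕ (iter f k i)) (upTo N)
    listed? : ∀ i → Dec (Listed i)
    listed? i = All.all? (λ k → toℕ i ≤? toℕ (iter f k i)) (upTo N)
    listed⇒min : ∀ i → Listed i → CycleMinimum i
    listed⇒min i listed j i∼j with ∼-bounded i∼j
    ... | k , k<N , refl = All.lookup listed (Membershipₚ.∈-upTo⁺ k<N)
    min⇒listed : ∀ i → CycleMinimum i → Listed i
    min⇒listed i min = All.tabulate (λ {k} _ → min (iter f k i) (k , refl))

  minimal-period : ∀ i → ∃[ L ] OnCycleOfLength f i L
  minimal-period i with period i
  ... | p , _ , per with least-witness (λ m → (1 ≤? m) ×-dec (iter f m i ≟ i)) {suc p} (ℕ.s≤s ℕ.z≤n , per)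
  ...   | L , (1≤L , returns) , earlier = L , 1≤L , returns , λ m 1≤m m<L returns′ → earlier m<L (1≤m , returns′)

  cycle-size : ∀ {i L} → OnCycleOfLength f i L → count (i ∼?_) ≡ L
  cycle-size {i} {suc L} (_ , returns , minimal) =
    trans (count-⇔ (i ∼?_) (λ j → Finₚ.any? (λ m → g m ≟ j)) on-cycle⇒in-image (λ j (m , gm≡j) → toℕ m , gm≡j))
          (count-image g g-injective)
    where
    g : Fin (suc L) → Fin N
    g m = iter f (toℕ m) i
    on-cycle⇒in-image : ∀ j → i ∼ j → ∃[ m ] g m ≡ j
    on-cycle⇒in-image j (k , iterₖ≡j) = fromℕ< (m%n<n k (suc L)) ,
      trans (cong (λ m → iter f m i) (Finₚ.toℕ-fromℕ< (m%n<n k (suc L)))) (trans (iter-mod f returns k) iterₖ≡j)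
    no-early-return : ∀ {x y} → toℕ x ℕ.< toℕ y → g x ≢ g y
    no-early-return {x} {y} x<y gx≡gy =
      minimal d (ℕₚ.m<n⇒0<n∸m x<y) (ℕₚ.≤-<-trans (ℕₚ.m∸n≤m (toℕ y) (toℕ x)) (Finₚ.toℕ<n y))
        (iter-injective (toℕ x) (begin
          iter f (toℕ x) (iter f d i)  ≡⟨ iter-+ f (toℕ x) d i ⟨
          iter f (toℕ x ℕ.+ d) i       ≡⟨ cong (λ m → iter f m i) (ℕₚ.m+[n∸m]≡n (ℕₚ.<⇒≤ x<y)) ⟩
          iter f (toℕ y) i             ≡⟨ gx≡gy ⟨
          iter f (toℕ x) i             ∎))
      where d = toℕ y ℕ.∸ toℕ x
    g-injective : Injective _≡_ _≡_ g
    g-injective {x} {y} gx≡gy with ℕₚ.<-cmp (toℕ x) (toℕ y)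
    ... | tri< x<y _ _ = ⊥-elim (no-early-return x<y gx≡gy)
    ... | tri≈ _ x≡y _ = Finₚ.toℕ-injective x≡y
    ... | tri> _ _ y<x = ⊥-elim (no-early-return y<x (sym gx≡gy))

  cycleWeight : (Fin N → ℤ) → Fin N → ℤ
  cycleWeight v i = ∏ (λ j → cycleFactor (i ∼? j) (v j))

  -- A cycle contributes a block of determinant ±(1 - its weight), so weight 1 is the singular case.
  HasSingularCycle : (Fin N → ℤ) → Set
  HasSingularCycle v = ∃[ i ] cycleWeight v i ≡ 1ℤ

  cycleWeight-∼ : ∀ v {i i′} → i ∼ i′ → cycleWeight v i ≡ cycleWeight v i′
  cycleWeight-∼ v {i} {i′} i∼i′ = ℤΠ.sum-cong-≗ λ j →
    cycleFactor-⇔ (i ∼? j) (i′ ∼? j) (v j) (∼-trans (∼-sym i∼i′)) (∼-trans i∼i′)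

  hasSingularCycle⇔hasEvenCycle : HasSingularCycle (λ _ → 1ℤ) ⇔ HasEvenCycle f
  hasSingularCycle⇔hasEvenCycle = mk⇔ singular⇒even even⇒singular
    where
    cycleWeight-1 : ∀ i → cycleWeight (λ _ → 1ℤ) i ≡ negOnePow (count (i ∼?_))
    cycleWeight-1 i = trans (ℤΠ.sum-cong-≗ (λ j → cycleFactor-1 (i ∼? j))) (negOnePow-∑ (λ j → χ (i ∼? j)))
    singular⇒even : HasSingularCycle (λ _ → 1ℤ) → HasEvenCycle f
    singular⇒even (i , weight≡1) with minimal-period i
    ... | L , on-cycle = i , L , on-cycle , negOnePow≡1⇒even L (begin
      negOnePow L                      ≡⟨ cong negOnePow (cycle-size on-cycle) ⟨
      negOnePow (count (i ∼?_))        ≡⟨ cycleWeight-1 i ⟨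
      cycleWeight (λ _ → 1ℤ) i         ≡⟨ weight≡1 ⟩
      1ℤ                               ∎)
    even⇒singular : HasEvenCycle f → HasSingularCycle (λ _ → 1ℤ)
    even⇒singular (i , L , on-cycle , 2∣L) =
      i , trans (cycleWeight-1 i) (trans (cong negOnePow (cycle-size on-cycle)) (even⇒negOnePow≡1 L 2∣L))

-- Cutting a point out of its cycle

bypass : ∀ {n} → (Fin n → Fin n) → Fin n → Fin n → Fin n
bypass f a x = if does (f x ≟ a) then f a else f x

bypass-≡ : ∀ {n} (f : Fin n → Fin n) {a x} → f x ≡ a → bypass f a x ≡ f a
bypass-≡ f {a} {x} fx≡a rewrite dec-true (f x ≟ a) fx≡a = refl

bypass-≢ : ∀ {n} (f : Fin n → Fin n) {a x} → f x ≢ a → bypass f a x ≡ f x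
bypass-≢ f {a} {x} fx≢a rewrite dec-false (f x ≟ a) fx≢a = refl

-- The merged edge x → a → f a carries the weight that keeps each cycle product ∏ (- v) unchanged.
bypassWeight : ∀ {n} → (Fin n → Fin n) → Fin n → (Fin n → ℤ) → Fin n → ℤ
bypassWeight f a v x = if does (f x ≟ a) then - (v a * v x) else v x

bypassWeight-≡ : ∀ {n} (f : Fin n → Fin n) {a} v {x} → f x ≡ a → bypassWeight f a v x ≡ - (v a * v x)
bypassWeight-≡ f {a} v {x} fx≡a rewrite dec-true (f x ≟ a) fx≡a = refl

bypassWeight-≢ : ∀ {n} (f : Fin n → Fin n) {a} v {x} → f x ≢ a → bypassWeight f a v x ≡ v x
bypassWeight-≢ f {a} v {x} fx≢a rewrite dec-false (f x ≟ a) fx≢a = refl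

module Bypass {n} (f : Fin (suc n) → Fin (suc n)) (f-injective : Injective _≡_ _≡_ f) (a : Fin (suc n))
              (f′ : Fin n → Fin n) (f′-injective : Injective _≡_ _≡_ f′)
              (f′-bypasses : ∀ y → punchIn a (f′ y) ≡ bypass f a (punchIn a y)) where

  open Cycles f f-injective
  module ′ = Cycles f′ f′-injective
  open ′ using () renaming (_∼_ to _∼′_; _∼?_ to _∼′?_)

  infix 10 _⁺
  _⁺ : Fin n → Fin (suc n)
  y ⁺ = punchIn a y

  ⁺≢a : ∀ y → y ⁺ ≢ a
  ⁺≢a = Finₚ.punchInᵢ≢i a

  ⁺-injective : ∀ {y z} → y ⁺ ≡ z ⁺ → y ≡ z
  ⁺-injective = Finₚ.punchIn-injective a _ _

  f′⁺-≢ : ∀ {y} → f (y ⁺) ≢ a → f′ y ⁺ ≡ f (y ⁺)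
  f′⁺-≢ {y} fy⁺≢a = trans (f′-bypasses y) (bypass-≢ f fy⁺≢a)

  f′⁺-≡ : ∀ {y} → f (y ⁺) ≡ a → f′ y ⁺ ≡ f a
  f′⁺-≡ {y} fy⁺≡a = trans (f′-bypasses y) (bypass-≡ f fy⁺≡a)

  ∼-⁺-step : ∀ y → y ⁺ ∼ f′ y ⁺
  ∼-⁺-step y with f (y ⁺) ≟ a
  ... | no  fy⁺≢a = 1 , sym (f′⁺-≢ fy⁺≢a)
  ... | yes fy⁺≡a = 2 , sym (trans (f′⁺-≡ fy⁺≡a) (cong f (sym fy⁺≡a)))

  ∼′⇒∼ : ∀ {y z} → y ∼′ z → y ⁺ ∼ z ⁺
  ∼′⇒∼ (zero  , refl) = ∼-refl
  ∼′⇒∼ (suc k , refl) = ∼-trans (∼′⇒∼ (k , refl)) (∼-⁺-step _)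

  -- A path from y⁺ to z⁺ in f either avoids a or passes through it; both project to paths of f′.
  iter⇒∼′ : ∀ k {y z} → iter f k (y ⁺) ≡ z ⁺ → y ∼′ z
  iter-via-a⇒∼′ : ∀ k {y z} → f (y ⁺) ≡ a → iter f k a ≡ z ⁺ → y ∼′ z

  iter⇒∼′ zero    eq = 0 , ⁺-injective eq
  iter⇒∼′ (suc k) {y} eq with f (y ⁺) ≟ a
  ... | no  fy⁺≢a =
    ′.∼-trans (1 , refl) (iter⇒∼′ k (trans (cong (iter f k) (f′⁺-≢ fy⁺≢a)) (trans (iter-sucʳ f k (y ⁺)) eq)))
  ... | yes fy⁺≡a =
    iter-via-a⇒∼′ k fy⁺≡a (trans (cong (iter f k) (sym fy⁺≡a)) (trans (iter-sucʳ f k (y ⁺)) eq))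

  iter-via-a⇒∼′ zero    {z = z} _ eq = ⊥-elim (⁺≢a z (sym eq))
  iter-via-a⇒∼′ (suc k) fy⁺≡a eq =
    ′.∼-trans (1 , refl) (iter⇒∼′ k (trans (cong (iter f k) (f′⁺-≡ fy⁺≡a)) (trans (iter-sucʳ f k a) eq)))

  ∼⇒∼′ : ∀ {y z} → y ⁺ ∼ z ⁺ → y ∼′ z
  ∼⇒∼′ (k , iterₖ≡z⁺) = iter⇒∼′ k iterₖ≡z⁺

  cycleMinimum′-bound : ∀ {y j} → ′.CycleMinimum y → y ⁺ ∼ j → j ≢ a → toℕ (y ⁺) ℕ.≤ toℕ j
  cycleMinimum′-bound {y} {j} min y⁺∼j j≢a =
    subst (λ x → toℕ (y ⁺) ℕ.≤ toℕ x) j′⁺≡j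
      (Finₚ.punchIn-mono-≤ a y j′ (min j′ (∼⇒∼′ (subst (y ⁺ ∼_) (sym j′⁺≡j) y⁺∼j))))
    where
    j′ : Fin n
    j′ = punchOut (j≢a ∘ sym)
    j′⁺≡j : j′ ⁺ ≡ j
    j′⁺≡j = Finₚ.punchIn-punchOut (j≢a ∘ sym)

  cycleMinimum⁺⇒′ : ∀ {y} → CycleMinimum (y ⁺) → ′.CycleMinimum y
  cycleMinimum⁺⇒′ {y} min z y∼′z = Finₚ.punchIn-cancel-≤ a y z (min (z ⁺) (∼′⇒∼ y∼′z))

  cycleMinimum′⇒⁺ : ∀ {y} → ′.CycleMinimum y → (y ⁺ ∼ a → toℕ (y ⁺) ℕ.≤ toℕ a) → CycleMinimum (y ⁺)
  cycleMinimum′⇒⁺ min below-a j y⁺∼j with j ≟ a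
  ... | yes refl = below-a y⁺∼j
  ... | no  j≢a  = cycleMinimum′-bound min y⁺∼j j≢a

  χ-cycleMinimum-⁺ : ∀ y → (′.CycleMinimum y → y ⁺ ∼ a → toℕ (y ⁺) ℕ.≤ toℕ a) →
    χ (′.cycleMinimum? y) ≡ χ (cycleMinimum? (y ⁺))
  χ-cycleMinimum-⁺ y below-a =
    χ-⇔ (λ min → cycleMinimum′⇒⁺ min (below-a min)) cycleMinimum⁺⇒′ (′.cycleMinimum? y) (cycleMinimum? (y ⁺))

  cl-bypass-fixed : f a ≡ a → cl f ≡ suc (cl f′)
  cl-bypass-fixed fa≡a = begin
    cl f                                                   ≡⟨ cl≡count ⟩
    count cycleMinimum?                                    ≡⟨ count-remove cycleMinimum? a ⟩
    χ (cycleMinimum? a) ℕ.+ count (cycleMinimum? ∘ _⁺)     ≡⟨ cong₂ ℕ._+_ (χ-yes (cycleMinimum? a) a-minimum)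
                                                                 (ℕΣ.sum-cong-≗ λ y → sym (χ-cycleMinimum-⁺ y λ _ y⁺∼a →
                                                                   ⊥-elim (⁺≢a y (∼-fixed fa≡a (∼-sym y⁺∼a))))) ⟩
    suc (count ′.cycleMinimum?)                            ≡⟨ cong suc ′.cl≡count ⟨
    suc (cl f′)                                            ∎
    where
    a-minimum : CycleMinimum a
    a-minimum j a∼j = ℕₚ.≤-reflexive (cong toℕ (sym (∼-fixed fa≡a a∼j)))

  count-cycleMinimum′-below : ¬ CycleMinimum a → count ′.cycleMinimum? ≡ count (cycleMinimum? ∘ _⁺)
  count-cycleMinimum′-below ¬min with ¬cycleMinimum ¬min
  ... | j , a∼j , j<a = ℕΣ.sum-cong-≗ λ y → χ-cycleMinimum-⁺ y λ min y⁺∼a →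
    ℕₚ.<⇒≤ (ℕₚ.≤-<-trans (cycleMinimum′-bound min (∼-trans y⁺∼a a∼j) (λ j≡a → ℕₚ.<-irrefl (cong toℕ j≡a) j<a)) j<a)

  -- If a is the minimum of its cycle, the minimum m of the rest of the cycle becomes a cycle minimum for f′.
  module NextMinimum (fa≢a : f a ≢ a) (min : CycleMinimum a) where

    next : ∃[ m ] ((a ∼ m × m ≢ a) × (∀ y → a ∼ y × y ≢ a → toℕ m ℕ.≤ toℕ y))
    next = min-witness (λ j → (a ∼? j) ×-dec ¬? (j ≟ a)) {f a} ((1 , refl) , fa≢a)

    m : Fin (suc n)
    m = proj₁ next

    a∼m : a ∼ m
    a∼m = proj₁ (proj₁ (proj₂ next))

    m≢a : m ≢ a
    m≢a = proj₂ (proj₁ (proj₂ next))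

    m-least : ∀ y → a ∼ y × y ≢ a → toℕ m ℕ.≤ toℕ y
    m-least = proj₂ (proj₂ next)

    m′ : Fin n
    m′ = punchOut (m≢a ∘ sym)
    m′⁺≡m : m′ ⁺ ≡ m
    m′⁺≡m = Finₚ.punchIn-punchOut (m≢a ∘ sym)

    a<m : toℕ a ℕ.< toℕ m
    a<m = ℕₚ.≤∧≢⇒< (min m a∼m) (m≢a ∘ sym ∘ Finₚ.toℕ-injective)

    m′-minimum : ′.CycleMinimum m′
    m′-minimum z m′∼′z = Finₚ.punchIn-cancel-≤ a m′ z (subst (λ x → toℕ x ℕ.≤ toℕ (z ⁺)) (sym m′⁺≡m)
      (m-least (z ⁺) (∼-trans a∼m (subst (_∼ z ⁺) m′⁺≡m (∼′⇒∼ m′∼′z)) , ⁺≢a z)))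

    m′⁺-not-minimum : ¬ CycleMinimum (m′ ⁺)
    m′⁺-not-minimum min′ =
      ℕₚ.<⇒≱ a<m (subst (λ x → toℕ x ℕ.≤ toℕ a) m′⁺≡m (min′ a (subst (_∼ a) (sym m′⁺≡m) (∼-sym a∼m))))

    only-m′ : ∀ {y} → ′.CycleMinimum y → y ⁺ ∼ a → y ≡ m′
    only-m′ {y} min′ y⁺∼a = ⁺-injective (trans (Finₚ.toℕ-injective (ℕₚ.≤-antisym
      (cycleMinimum′-bound min′ (∼-trans y⁺∼a a∼m) m≢a) (m-least (y ⁺) (∼-sym y⁺∼a , ⁺≢a y)))) (sym m′⁺≡m))

    χ-cycleMinimum′ : ∀ y → χ (′.cycleMinimum? y) ≡ χ (cycleMinimum? (y ⁺)) ℕ.+ χ (y ≟ m′)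
    χ-cycleMinimum′ y with y ≟ m′
    ... | yes refl = begin
      χ (′.cycleMinimum? m′)                 ≡⟨ χ-yes (′.cycleMinimum? m′) m′-minimum ⟩
      1                                      ≡⟨ cong (ℕ._+ 1) (χ-no (cycleMinimum? (m′ ⁺)) m′⁺-not-minimum) ⟨
      χ (cycleMinimum? (m′ ⁺)) ℕ.+ 1         ∎
    ... | no y≢m′ = begin
      χ (′.cycleMinimum? y)                  ≡⟨ χ-cycleMinimum-⁺ y (λ min′ y⁺∼a → ⊥-elim (y≢m′ (only-m′ min′ y⁺∼a))) ⟩
      χ (cycleMinimum? (y ⁺))                ≡⟨ ℕₚ.+-identityʳ _ ⟨
      χ (cycleMinimum? (y ⁺)) ℕ.+ 0          ∎

    count-cycleMinimum′ : count ′.cycleMinimum? ≡ 1 ℕ.+ count (cycleMinimum? ∘ _⁺)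
    count-cycleMinimum′ = begin
      count ′.cycleMinimum?                              ≡⟨ ℕΣ.sum-cong-≗ χ-cycleMinimum′ ⟩
      ℕΣ.sum (λ y → χ (cycleMinimum? (y ⁺)) ℕ.+ χ (y ≟ m′))
        ≡⟨ ℕΣ.∑-distrib-+ (χ ∘ cycleMinimum? ∘ _⁺) (χ ∘ (_≟ m′)) ⟩
      count (cycleMinimum? ∘ _⁺) ℕ.+ count (_≟ m′)       ≡⟨ cong (ℕ._+_ (count (cycleMinimum? ∘ _⁺))) (count-≡ m′) ⟩
      count (cycleMinimum? ∘ _⁺) ℕ.+ 1                   ≡⟨ ℕₚ.+-comm _ 1 ⟩
      1 ℕ.+ count (cycleMinimum? ∘ _⁺)                   ∎

  cl-bypass-moved : f a ≢ a → cl f ≡ cl f′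
  cl-bypass-moved fa≢a = begin
    cl f                                                   ≡⟨ cl≡count ⟩
    count cycleMinimum?                                    ≡⟨ count-remove cycleMinimum? a ⟩
    χ (cycleMinimum? a) ℕ.+ count (cycleMinimum? ∘ _⁺)     ≡⟨ a-accounted-for (cycleMinimum? a) ⟩
    count ′.cycleMinimum?                                  ≡⟨ ′.cl≡count ⟨
    cl f′                                                  ∎
    where
    a-accounted-for : (min? : Dec (CycleMinimum a)) → χ min? ℕ.+ count (cycleMinimum? ∘ _⁺) ≡ count ′.cycleMinimum?
    a-accounted-for (no  ¬min) = sym (count-cycleMinimum′-below ¬min)
    a-accounted-for (yes min)  = sym (NextMinimum.count-cycleMinimum′ fa≢a min)

  cycleWeight-fixed : ∀ v → f a ≡ a → cycleWeight v a ≡ - v a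
  cycleWeight-fixed v fa≡a = begin
    ∏ t                ≡⟨ ℤΠ.sum-remove {i = a} t ⟩
    t a * ∏ (t ∘ _⁺)
      ≡⟨ cong₂ _*_ (cycleFactor-yes (a ∼? a) (v a) ∼-refl) (trans (ℤΠ.sum-cong-≗ off-cycle) (ℤΠ.sum-replicate-zero n)) ⟩
    - v a * 1ℤ         ≡⟨ ℤₚ.*-identityʳ (- v a) ⟩
    - v a              ∎
    where
    t : Fin (suc n) → ℤ
    t j = cycleFactor (a ∼? j) (v j)
    off-cycle : ∀ y → t (y ⁺) ≡ 1ℤ
    off-cycle y = cycleFactor-no (a ∼? y ⁺) (v (y ⁺)) (λ a∼y⁺ → ⁺≢a y (∼-fixed fa≡a a∼y⁺))

  module _ (v : Fin (suc n) → ℤ) (v′ : Fin n → ℤ) (v′-bypasses : ∀ y → v′ y ≡ bypassWeight f a v (y ⁺)) where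

    module OnTheCycleOf (y : Fin n) where

      t : Fin (suc n) → ℤ
      t j = cycleFactor (y ⁺ ∼? j) (v j)

      t′ : Fin n → ℤ
      t′ z = cycleFactor (y ∼′? z) (v′ z)

      factor-⁺ : ∀ z → (y ⁺ ∼ z ⁺ → f (z ⁺) ≢ a) → t′ z ≡ t (z ⁺)
      factor-⁺ z off-a with y ⁺ ∼? z ⁺
      ... | yes y⁺∼z⁺ = trans (cycleFactor-yes (y ∼′? z) (v′ z) (∼⇒∼′ y⁺∼z⁺))
                              (cong -_ (trans (v′-bypasses z) (bypassWeight-≢ f v (off-a y⁺∼z⁺))))
      ... | no  y⁺≁z⁺ = cycleFactor-no (y ∼′? z) (v′ z) (y⁺≁z⁺ ∘ ∼′⇒∼)

      weight-avoiding-a : ¬ y ⁺ ∼ a → ∏ t′ ≡ ∏ t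
      weight-avoiding-a y⁺≁a = begin
        ∏ t′
          ≡⟨ ℤΠ.sum-cong-≗ (λ z → factor-⁺ z λ y⁺∼z⁺ fz⁺≡a → y⁺≁a (subst (y ⁺ ∼_) fz⁺≡a (∼-step y⁺∼z⁺))) ⟩
        ∏ (t ∘ _⁺)         ≡⟨ ℤₚ.*-identityˡ _ ⟨
        1ℤ * ∏ (t ∘ _⁺)    ≡⟨ cong (_* ∏ (t ∘ _⁺)) (cycleFactor-no (y ⁺ ∼? a) (v a) y⁺≁a) ⟨
        t a * ∏ (t ∘ _⁺)   ≡⟨ ℤΠ.sum-remove {i = a} t ⟨
        ∏ t                ∎

      -- The merged edge u → f a, where f u = a, accounts for the factor of a.
      module ThroughA (y⁺∼a : y ⁺ ∼ a) where

        fa≢a : f a ≢ a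
        fa≢a fa≡a = ⁺≢a y (∼-fixed fa≡a (∼-sym y⁺∼a))

        u : Fin (suc n)
        u = proj₁ (predecessor a)

        fu≡a : f u ≡ a
        fu≡a = proj₂ (predecessor a)

        u≢a : u ≢ a
        u≢a u≡a = fa≢a (subst (λ x → f x ≡ a) u≡a fu≡a)

        u′ : Fin n
        u′ = punchOut (u≢a ∘ sym)

        u′⁺≡u : u′ ⁺ ≡ u
        u′⁺≡u = Finₚ.punchIn-punchOut (u≢a ∘ sym)

        fu′⁺≡a : f (u′ ⁺) ≡ a
        fu′⁺≡a = trans (cong f u′⁺≡u) fu≡a

        y⁺∼u′⁺ : y ⁺ ∼ u′ ⁺
        y⁺∼u′⁺ = subst (y ⁺ ∼_) (sym u′⁺≡u) (∼-unstep (subst (y ⁺ ∼_) (sym fu≡a) y⁺∼a))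

        away-from-u′ : ∀ z → z ≢ u′ → t′ z ≡ t (z ⁺)
        away-from-u′ z z≢u′ = factor-⁺ z λ _ fz⁺≡a → z≢u′ (⁺-injective (f-injective (trans fz⁺≡a (sym fu′⁺≡a))))

        at-u′ : t′ u′ ≡ t a * t (u′ ⁺)
        at-u′ = begin
          t′ u′                 ≡⟨ cycleFactor-yes (y ∼′? u′) (v′ u′) (∼⇒∼′ y⁺∼u′⁺) ⟩
          - v′ u′               ≡⟨ cong -_ (trans (v′-bypasses u′) (bypassWeight-≡ f v fu′⁺≡a)) ⟩
          - - (v a * v (u′ ⁺))  ≡⟨ neg-neg (v a) (v (u′ ⁺)) ⟩
          - v a * - v (u′ ⁺)    ≡⟨ cong₂ _*_ (cycleFactor-yes (y ⁺ ∼? a) (v a) y⁺∼a)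
                                             (cycleFactor-yes (y ⁺ ∼? u′ ⁺) (v (u′ ⁺)) y⁺∼u′⁺) ⟨
          t a * t (u′ ⁺)        ∎
          where
          neg-neg : ∀ x y → - - (x * y) ≡ - x * - y
          neg-neg = solve-∀

        weight-through-a : ∏ t′ ≡ ∏ t
        weight-through-a = begin
          ∏ t′               ≡⟨ ∏-scale-at (t ∘ _⁺) t′ u′ (t a) away-from-u′ at-u′ ⟩
          t a * ∏ (t ∘ _⁺)   ≡⟨ ℤΠ.sum-remove {i = a} t ⟨
          ∏ t                ∎

      weight : Dec (y ⁺ ∼ a) → ∏ t′ ≡ ∏ t
      weight (no  y⁺≁a) = weight-avoiding-a y⁺≁a
      weight (yes y⁺∼a) = ThroughA.weight-through-a y⁺∼a

    cycleWeight-bypass : ∀ y → ′.cycleWeight v′ y ≡ cycleWeight v (y ⁺)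
    cycleWeight-bypass y = OnTheCycleOf.weight y (y ⁺ ∼? a)

    hasSingularCycle-bypass : HasSingularCycle v ⇔ ((f a ≡ a × - v a ≡ 1ℤ) ⊎ ′.HasSingularCycle v′)
    hasSingularCycle-bypass = mk⇔ singular⇒ singular⇐
      where
      off-a : ∀ {i} → i ≢ a → cycleWeight v i ≡ 1ℤ → ′.HasSingularCycle v′
      off-a {i} i≢a singular = punchOut (i≢a ∘ sym) ,
        trans (cycleWeight-bypass _) (trans (cong (cycleWeight v) (Finₚ.punchIn-punchOut (i≢a ∘ sym))) singular)
      singular⇒ : HasSingularCycle v → (f a ≡ a × - v a ≡ 1ℤ) ⊎ ′.HasSingularCycle v′
      singular⇒ (i , singular) with i ≟ a
      ... | no  i≢a  = inj₂ (off-a i≢a singular)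
      ... | yes refl with f i ≟ i
      ...   | yes fa≡a = inj₁ (fa≡a , trans (sym (cycleWeight-fixed v fa≡a)) singular)
      ...   | no  fa≢a = inj₂ (off-a fa≢a (trans (sym (cycleWeight-∼ v (1 , refl))) singular))
      singular⇐ : (f a ≡ a × - v a ≡ 1ℤ) ⊎ ′.HasSingularCycle v′ → HasSingularCycle v
      singular⇐ (inj₁ (fa≡a , -va≡1)) = a , trans (cycleWeight-fixed v fa≡a) -va≡1
      singular⇐ (inj₂ (y , singular))  = y ⁺ , trans (sym (cycleWeight-bypass y)) singular

-- The weighted matrix

indic-≡ : ∀ {n} (a : Fin n) → indic a a ≡ 1ℤ
indic-≡ a rewrite dec-true (a ≟ a) refl = refl

indic-≢ : ∀ {n} {a b : Fin n} → a ≢ b → indic a b ≡ 0ℤ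
indic-≢ {a = a} {b} a≢b rewrite dec-false (a ≟ b) a≢b = refl

indic-punchIn : ∀ {n} (a : Fin (suc n)) x k → indic (punchIn a x) (punchIn a k) ≡ indic x k
indic-punchIn a x k = cong (λ b → if b then 1ℤ else 0ℤ)
  (does-⇔ (mk⇔ (Finₚ.punchIn-injective a x k) (cong (punchIn a))) (punchIn a x ≟ punchIn a k) (x ≟ k))

weightedCmat : ∀ {n} → Permutation′ n → Permutation′ n → (Fin n → ℤ) → Matrix n
weightedCmat ρ₁ ρ₂ w i j = indic (ρ₁ ⟨$⟩ʳ i) j + w i * indic (ρ₂ ⟨$⟩ʳ i) j

det-Cmat≡det-weightedCmat : ∀ {n} (ρ₁ ρ₂ : Permutation′ n) →
  det (Cmat ρ₁ ρ₂) ≡ det (weightedCmat ρ₁ ρ₂ (λ _ → 1ℤ))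
det-Cmat≡det-weightedCmat ρ₁ ρ₂ = det-cong λ i j → cong (_+_ (indic (ρ₁ ⟨$⟩ʳ i) j)) (sym (ℤₚ.*-identityˡ _))

-- The edge x → ρ₀ x carries the weight of row ρ₁⁻¹ x.
vertexWeight : ∀ {n} → Permutation′ n → (Fin n → ℤ) → Fin n → ℤ
vertexWeight ρ₁ w x = w (ρ₁ ⟨$⟩ˡ x)

vertexWeight-permute : ∀ {n} (ρ₁ : Permutation′ n) w i → vertexWeight ρ₁ w (ρ₁ ⟨$⟩ʳ i) ≡ w i
vertexWeight-permute ρ₁ w i = cong w (Perm.inverseˡ ρ₁)

permute-suc : ∀ {n} (ρ : Permutation′ (suc n)) r → ρ ⟨$⟩ʳ suc r ≡ punchIn (ρ ⟨$⟩ʳ zero) (remove zero ρ ⟨$⟩ʳ r)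
permute-suc ρ = Perm.punchIn-permute ρ zero

permute-suc≢permute-zero : ∀ {n} (ρ : Permutation′ (suc n)) r → ρ ⟨$⟩ʳ suc r ≢ ρ ⟨$⟩ʳ zero
permute-suc≢permute-zero ρ r eq =
  Finₚ.0≢1+n (trans (sym (Perm.inverseˡ ρ)) (trans (cong (ρ ⟨$⟩ˡ_) (sym eq)) (Perm.inverseˡ ρ)))

rho0-permute : ∀ {n} (ρ₁ ρ₂ : Permutation′ n) i → rho0 ρ₁ ρ₂ (ρ₁ ⟨$⟩ʳ i) ≡ ρ₂ ⟨$⟩ʳ i
rho0-permute ρ₁ ρ₂ i = cong (ρ₂ ⟨$⟩ʳ_) (Perm.inverseˡ ρ₁)

minor-weightedCmat : ∀ {n} (ρ₁ σ : Permutation′ (suc n)) w → ρ₁ ⟨$⟩ʳ zero ≡ σ ⟨$⟩ʳ zero →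
  ∀ r k → minor (weightedCmat ρ₁ σ w) (ρ₁ ⟨$⟩ʳ zero) r k ≡
          weightedCmat (remove zero ρ₁) (remove zero σ) (w ∘ suc) r k
minor-weightedCmat {n} ρ₁ σ w a≡σ₀ r k = cong₂ (λ x y → x + w (suc r) * y) (entry ρ₁ refl) (entry σ a≡σ₀)
  where
  a : Fin (suc n)
  a = ρ₁ ⟨$⟩ʳ zero
  entry : ∀ ρ → a ≡ ρ ⟨$⟩ʳ zero → indic (ρ ⟨$⟩ʳ suc r) (punchIn a k) ≡ indic (remove zero ρ ⟨$⟩ʳ r) k
  entry ρ a≡ρ₀ = trans (cong (λ x → indic x (punchIn a k))
                             (trans (permute-suc ρ r) (cong (λ p → punchIn p (remove zero ρ ⟨$⟩ʳ r)) (sym a≡ρ₀))))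
                       (indic-punchIn a (remove zero ρ ⟨$⟩ʳ r) k)

det-weightedCmat-coincident : ∀ {n} (ρ₁ ρ₂ : Permutation′ (suc n)) w → ρ₁ ⟨$⟩ʳ zero ≡ ρ₂ ⟨$⟩ʳ zero →
  det (weightedCmat ρ₁ ρ₂ w) ≡
  negOnePow (toℕ (ρ₁ ⟨$⟩ʳ zero)) * ((1ℤ + w zero) * det (weightedCmat (remove zero ρ₁) (remove zero ρ₂) (w ∘ suc)))
det-weightedCmat-coincident {n} ρ₁ ρ₂ w a≡c = begin
  det A                                       ≡⟨ det-single-entry-first-row A a off-a ⟩
  s * (A zero a * det (minor A a))
    ≡⟨ cong₂ (λ x d → s * (x * d)) at-a (det-cong (minor-weightedCmat ρ₁ ρ₂ w a≡c)) ⟩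
  s * ((1ℤ + w zero) * det (weightedCmat (remove zero ρ₁) (remove zero ρ₂) (w ∘ suc)))  ∎
  where
  a : Fin (suc n)
  a = ρ₁ ⟨$⟩ʳ zero
  s : ℤ
  s = negOnePow (toℕ a)
  A : Matrix (suc n)
  A = weightedCmat ρ₁ ρ₂ w
  off-a : ∀ j → j ≢ a → A zero j ≡ 0ℤ
  off-a j j≢a = begin
    indic a j + w zero * indic (ρ₂ ⟨$⟩ʳ zero) j
      ≡⟨ cong₂ (λ x y → x + w zero * y) (indic-≢ (j≢a ∘ sym)) (indic-≢ (j≢a ∘ sym ∘ trans a≡c)) ⟩
    0ℤ + w zero * 0ℤ                            ≡⟨ trans (ℤₚ.+-identityˡ _) (ℤₚ.*-zeroʳ (w zero)) ⟩
    0ℤ                                          ∎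
  at-a : A zero a ≡ 1ℤ + w zero
  at-a = cong₂ (λ x y → x + w zero * y) (indic-≡ a) (trans (cong (λ x → indic x a) (sym a≡c)) (indic-≡ a))
         ∙ cong (_+_ 1ℤ) (ℤₚ.*-identityʳ (w zero))
    where _∙_ = trans

-- When ρ₁ 0 ≠ ρ₂ 0, the column operation (column c) -= w 0 · (column a) clears the first row except
-- for a 1 at column a; the minor is again a weighted C-matrix, for the permutation σ = ρ₂ ∘ (0 u)
-- whose ρ₀ cuts a out of its cycle.
module Distinct {n} (ρ₁ ρ₂ : Permutation′ (suc n)) (w : Fin (suc n) → ℤ)
                (a≢c : ρ₁ ⟨$⟩ʳ zero ≢ ρ₂ ⟨$⟩ʳ zero) where

  a c u : Fin (suc n)
  a = ρ₁ ⟨$⟩ʳ zero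
  c = ρ₂ ⟨$⟩ʳ zero
  u = ρ₂ ⟨$⟩ˡ a

  f : Fin (suc n) → Fin (suc n)
  f = rho0 ρ₁ ρ₂

  v : Fin (suc n) → ℤ
  v = vertexWeight ρ₁ w

  σ : Permutation′ (suc n)
  σ = transpose zero u ∘ₚ ρ₂

  w̃ : Fin (suc n) → ℤ
  w̃ i = bypassWeight f a v (ρ₁ ⟨$⟩ʳ i)

  σ-zero : σ ⟨$⟩ʳ zero ≡ a
  σ-zero = Perm.inverseʳ ρ₂

  ρ₂≡a⇒u : ∀ {i} → ρ₂ ⟨$⟩ʳ i ≡ a → i ≡ u
  ρ₂≡a⇒u ρ₂i≡a = trans (sym (Perm.inverseˡ ρ₂)) (cong (ρ₂ ⟨$⟩ˡ_) ρ₂i≡a)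

  σ-suc-≡ : ∀ r → ρ₂ ⟨$⟩ʳ suc r ≡ a → σ ⟨$⟩ʳ suc r ≡ c
  σ-suc-≡ r ρ₂s≡a rewrite dec-true (suc r ≟ u) (ρ₂≡a⇒u ρ₂s≡a) = refl

  σ-suc-≢ : ∀ r → ρ₂ ⟨$⟩ʳ suc r ≢ a → σ ⟨$⟩ʳ suc r ≡ ρ₂ ⟨$⟩ʳ suc r
  σ-suc-≢ r ρ₂s≢a
    rewrite dec-false (suc r ≟ u) (λ s≡u → ρ₂s≢a (trans (cong (ρ₂ ⟨$⟩ʳ_) s≡u) (Perm.inverseʳ ρ₂))) = refl

  w̃-≡ : ∀ {i} → ρ₂ ⟨$⟩ʳ i ≡ a → w̃ i ≡ - (w zero * w i)
  w̃-≡ {i} ρ₂i≡a = trans (bypassWeight-≡ f v (trans (rho0-permute ρ₁ ρ₂ i) ρ₂i≡a))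
                        (cong₂ (λ x y → - (x * y)) (vertexWeight-permute ρ₁ w zero) (vertexWeight-permute ρ₁ w i))

  w̃-≢ : ∀ {i} → ρ₂ ⟨$⟩ʳ i ≢ a → w̃ i ≡ w i
  w̃-≢ {i} ρ₂i≢a = trans (bypassWeight-≢ f v (ρ₂i≢a ∘ trans (sym (rho0-permute ρ₁ ρ₂ i)))) (vertexWeight-permute ρ₁ w i)

  σ-bypasses : ∀ r → σ ⟨$⟩ʳ suc r ≡ bypass f a (ρ₁ ⟨$⟩ʳ suc r)
  σ-bypasses r with ρ₂ ⟨$⟩ʳ suc r ≟ a
  ... | yes ρ₂s≡a = trans (σ-suc-≡ r ρ₂s≡a)
    (sym (trans (bypass-≡ f (trans (rho0-permute ρ₁ ρ₂ (suc r)) ρ₂s≡a)) (rho0-permute ρ₁ ρ₂ zero)))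
  ... | no  ρ₂s≢a = trans (σ-suc-≢ r ρ₂s≢a)
    (sym (trans (bypass-≢ f (ρ₂s≢a ∘ trans (sym (rho0-permute ρ₁ ρ₂ (suc r))))) (rho0-permute ρ₁ ρ₂ (suc r))))

  A W M′ : Matrix (suc n)
  A = weightedCmat ρ₁ ρ₂ w
  W = weightedCmat ρ₁ σ w̃
  M′ = withColumn c (λ i → A i c + (- w zero) * A i a) A

  A-column-a : ∀ r → ρ₂ ⟨$⟩ʳ suc r ≢ a → A (suc r) a ≡ 0ℤ
  A-column-a r ρ₂s≢a = begin
    indic (ρ₁ ⟨$⟩ʳ suc r) a + w (suc r) * indic (ρ₂ ⟨$⟩ʳ suc r) a
      ≡⟨ cong₂ (λ x y → x + w (suc r) * y) (indic-≢ (permute-suc≢permute-zero ρ₁ r)) (indic-≢ ρ₂s≢a) ⟩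
    0ℤ + w (suc r) * 0ℤ
      ≡⟨ trans (ℤₚ.+-identityˡ _) (ℤₚ.*-zeroʳ (w (suc r))) ⟩
    0ℤ  ∎

  M′-unchanged : ∀ i l → A i a ≡ 0ℤ → M′ i l ≡ A i l
  M′-unchanged i l Aia≡0 with l ≟ c
  ... | yes refl = trans (cong (λ x → A i l + (- w zero) * x) Aia≡0)
                         (trans (cong (_+_ (A i l)) (ℤₚ.*-zeroʳ (- w zero))) (ℤₚ.+-identityʳ (A i l)))
  ... | no  _    = refl

  first-row : ∀ j → j ≢ a → M′ zero j ≡ 0ℤ
  first-row j j≢a with j ≟ c
  ... | yes refl = begin
    (indic a c + w zero * indic c c) + (- w zero) * (indic a a + w zero * indic c a)
      ≡⟨ cong₂ (λ x y → (x + w zero * indic c c) + (- w zero) * (indic a a + w zero * y))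
               (indic-≢ a≢c) (indic-≢ (a≢c ∘ sym)) ⟩
    (0ℤ + w zero * indic c c) + (- w zero) * (indic a a + w zero * 0ℤ)
      ≡⟨ cong₂ (λ x y → (0ℤ + w zero * x) + (- w zero) * (y + w zero * 0ℤ)) (indic-≡ c) (indic-≡ a) ⟩
    (0ℤ + w zero * 1ℤ) + (- w zero) * (1ℤ + w zero * 0ℤ)     ≡⟨ cancel (w zero) ⟩
    0ℤ                                                           ∎
    where
    cancel : ∀ x → (0ℤ + x * 1ℤ) + (- x) * (1ℤ + x * 0ℤ) ≡ 0ℤ
    cancel = solve-∀
  ... | no j≢c = begin
    indic a j + w zero * indic c j
      ≡⟨ cong₂ (λ x y → x + w zero * y) (indic-≢ (j≢a ∘ sym)) (indic-≢ (j≢c ∘ sym)) ⟩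
    0ℤ + w zero * 0ℤ                   ≡⟨ trans (ℤₚ.+-identityˡ _) (ℤₚ.*-zeroʳ (w zero)) ⟩
    0ℤ                                 ∎

  first-row-a : M′ zero a ≡ 1ℤ
  first-row-a = begin
    M′ zero a                       ≡⟨ withColumn-≢ _ A zero a≢c ⟩
    indic a a + w zero * indic c a  ≡⟨ cong₂ (λ x y → x + w zero * y) (indic-≡ a) (indic-≢ (a≢c ∘ sym)) ⟩
    1ℤ + w zero * 0ℤ                ≡⟨ cong (_+_ 1ℤ) (ℤₚ.*-zeroʳ (w zero)) ⟩
    1ℤ                              ∎

  module _ (r : Fin n) (ρ₂s≡a : ρ₂ ⟨$⟩ʳ suc r ≡ a) where

    A-redirected-row : ∀ l → A (suc r) l ≡ indic (ρ₁ ⟨$⟩ʳ suc r) l + w (suc r) * indic a l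
    A-redirected-row l = cong (λ p → indic (ρ₁ ⟨$⟩ʳ suc r) l + w (suc r) * indic p l) ρ₂s≡a

    W-redirected-row : ∀ l → W (suc r) l ≡ indic (ρ₁ ⟨$⟩ʳ suc r) l + (- (w zero * w (suc r))) * indic c l
    W-redirected-row l = cong₂ (λ p q → indic (ρ₁ ⟨$⟩ʳ suc r) l + p * indic q l) (w̃-≡ ρ₂s≡a) (σ-suc-≡ r ρ₂s≡a)

    A-redirected-a : A (suc r) a ≡ w (suc r)
    A-redirected-a = begin
      A (suc r) a                                          ≡⟨ A-redirected-row a ⟩
      indic (ρ₁ ⟨$⟩ʳ suc r) a + w (suc r) * indic a a       ≡⟨ cong₂ (λ x y → x + w (suc r) * y)
                                                                (indic-≢ (permute-suc≢permute-zero ρ₁ r)) (indic-≡ a) ⟩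
      0ℤ + w (suc r) * 1ℤ                                  ≡⟨ trans (ℤₚ.+-identityˡ _) (ℤₚ.*-identityʳ (w (suc r))) ⟩
      w (suc r)                                            ∎

    off-a-c : ∀ {l} → l ≢ a → l ≢ c → A (suc r) l ≡ W (suc r) l
    off-a-c {l} l≢a l≢c = begin
      A (suc r) l                                       ≡⟨ A-redirected-row l ⟩
      x + w (suc r) * indic a l                         ≡⟨ cong (λ p → x + w (suc r) * p) (indic-≢ (l≢a ∘ sym)) ⟩
      x + w (suc r) * 0ℤ                                ≡⟨ cong (_+_ x) (trans (ℤₚ.*-zeroʳ (w (suc r))) (sym (ℤₚ.*-zeroʳ w′))) ⟩
      x + w′ * 0ℤ                                       ≡⟨ cong (λ p → x + w′ * p) (indic-≢ (l≢c ∘ sym)) ⟨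
      x + w′ * indic c l                                ≡⟨ W-redirected-row l ⟨
      W (suc r) l                                       ∎
      where
      x w′ : ℤ
      x = indic (ρ₁ ⟨$⟩ʳ suc r) l
      w′ = - (w zero * w (suc r))

    at-c : A (suc r) c + (- w zero) * A (suc r) a ≡ W (suc r) c
    at-c = begin
      A (suc r) c + (- w zero) * A (suc r) a
        ≡⟨ cong₂ (λ p q → p + (- w zero) * q) (A-redirected-row c) A-redirected-a ⟩
      (x + w (suc r) * indic a c) + (- w zero) * w (suc r)
        ≡⟨ cong (λ p → (x + w (suc r) * p) + (- w zero) * w (suc r)) (indic-≢ a≢c) ⟩
      (x + w (suc r) * 0ℤ) + (- w zero) * w (suc r)
        ≡⟨ merge x (w (suc r)) (w zero) ⟩
      x + (- (w zero * w (suc r))) * 1ℤ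
        ≡⟨ cong (λ p → x + (- (w zero * w (suc r))) * p) (indic-≡ c) ⟨
      x + (- (w zero * w (suc r))) * indic c c
        ≡⟨ W-redirected-row c ⟨
      W (suc r) c  ∎
      where
      x : ℤ
      x = indic (ρ₁ ⟨$⟩ʳ suc r) c
      merge : ∀ x y z → (x + y * 0ℤ) + (- z) * y ≡ x + (- (z * y)) * 1ℤ
      merge = solve-∀

  lower-rows : ∀ r l → l ≢ a → M′ (suc r) l ≡ W (suc r) l
  lower-rows r l l≢a with ρ₂ ⟨$⟩ʳ suc r ≟ a
  ... | no ρ₂s≢a = begin
    M′ (suc r) l  ≡⟨ M′-unchanged (suc r) l (A-column-a r ρ₂s≢a) ⟩
    A (suc r) l   ≡⟨ cong₂ (λ p q → indic (ρ₁ ⟨$⟩ʳ suc r) l + p * indic q l) (w̃-≢ ρ₂s≢a) (σ-suc-≢ r ρ₂s≢a) ⟨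
    W (suc r) l   ∎
  ... | yes ρ₂s≡a with l ≟ c
  ...   | yes refl = at-c r ρ₂s≡a
  ...   | no  l≢c  = off-a-c r ρ₂s≡a l≢a l≢c

  det-weightedCmat-distinct : det A ≡ negOnePow (toℕ a) * det (weightedCmat (remove zero ρ₁) (remove zero σ) (w̃ ∘ suc))
  det-weightedCmat-distinct = begin
    det A                                   ≡⟨ det-add-column-multiple A a≢c (- w zero) ⟨
    det M′                                  ≡⟨ det-single-entry-first-row M′ a first-row ⟩
    s * (M′ zero a * det (minor M′ a))      ≡⟨ cong₂ (λ x d → s * (x * d)) first-row-a (det-cong minor-M′) ⟩
    s * (1ℤ * det A′)                       ≡⟨ cong (s *_) (ℤₚ.*-identityˡ (det A′)) ⟩
    s * det A′                              ∎
    where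
    s : ℤ
    s = negOnePow (toℕ a)
    A′ : Matrix n
    A′ = weightedCmat (remove zero ρ₁) (remove zero σ) (w̃ ∘ suc)
    minor-M′ : ∀ r k → minor M′ a r k ≡ A′ r k
    minor-M′ r k = trans (lower-rows r (punchIn a k) (Finₚ.punchInᵢ≢i a k)) (minor-weightedCmat ρ₁ σ w̃ (sym σ-zero) r k)

-- The induction

rho0-injective : ∀ {n} (ρ₁ ρ₂ : Permutation′ n) → Injective _≡_ _≡_ (rho0 ρ₁ ρ₂)
rho0-injective ρ₁ ρ₂ {x} {y} eq = begin
  x                                  ≡⟨ Perm.inverseʳ ρ₁ ⟨
  ρ₁ ⟨$⟩ʳ (ρ₁ ⟨$⟩ˡ x)               ≡⟨ cong (ρ₁ ⟨$⟩ʳ_) (Perm.inverseˡ ρ₂) ⟨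
  ρ₁ ⟨$⟩ʳ (ρ₂ ⟨$⟩ˡ rho0 ρ₁ ρ₂ x)    ≡⟨ cong (λ z → ρ₁ ⟨$⟩ʳ (ρ₂ ⟨$⟩ˡ z)) eq ⟩
  ρ₁ ⟨$⟩ʳ (ρ₂ ⟨$⟩ˡ rho0 ρ₁ ρ₂ y)    ≡⟨ cong (ρ₁ ⟨$⟩ʳ_) (Perm.inverseˡ ρ₂) ⟩
  ρ₁ ⟨$⟩ʳ (ρ₁ ⟨$⟩ˡ y)               ≡⟨ Perm.inverseʳ ρ₁ ⟩
  y                                  ∎

permute-suc-inverse : ∀ {n} (ρ : Permutation′ (suc n)) y → ρ ⟨$⟩ʳ suc (remove zero ρ ⟨$⟩ˡ y) ≡ punchIn (ρ ⟨$⟩ʳ zero) y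
permute-suc-inverse ρ y = trans (permute-suc ρ _) (cong (punchIn (ρ ⟨$⟩ʳ zero)) (Perm.inverseʳ (remove zero ρ)))

PlusMinusOne : ℤ → Set
PlusMinusOne x = x ≡ 1ℤ ⊎ x ≡ -1ℤ

plusMinusOne-neg-* : ∀ {x y} → PlusMinusOne x → PlusMinusOne y → PlusMinusOne (- (x * y))
plusMinusOne-neg-* (inj₁ refl) (inj₁ refl) = inj₂ refl
plusMinusOne-neg-* (inj₁ refl) (inj₂ refl) = inj₁ refl
plusMinusOne-neg-* (inj₂ refl) (inj₁ refl) = inj₁ refl
plusMinusOne-neg-* (inj₂ refl) (inj₂ refl) = inj₂ refl

DetFormula : ∀ {n} → Permutation′ n → Permutation′ n → (Fin n → ℤ) → Set
DetFormula ρ₁ ρ₂ w =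
  (HasSingularCycle (vertexWeight ρ₁ w) → det (weightedCmat ρ₁ ρ₂ w) ≡ 0ℤ) ×
  (¬ HasSingularCycle (vertexWeight ρ₁ w) → det (weightedCmat ρ₁ ρ₂ w) ≡ sign ρ₁ * (+ 2) ^ cl (rho0 ρ₁ ρ₂))
  where open Cycles (rho0 ρ₁ ρ₂) (rho0-injective ρ₁ ρ₂)

-- Deleting row 0 and column a = ρ₁ 0 leaves the pair (ρ₁, σ) with 0 removed, where σ 0 = a
-- and σ agrees with ρ₂ except that the row mapped to a by ρ₂ is redirected past a.
module Reduction {n} (ρ₁ ρ₂ σ : Permutation′ (suc n)) (w : Fin (suc n) → ℤ) (w′ : Fin n → ℤ)
  (σ₀≡a : σ ⟨$⟩ʳ zero ≡ ρ₁ ⟨$⟩ʳ zero)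
  (σ-bypasses : ∀ r → σ ⟨$⟩ʳ suc r ≡ bypass (rho0 ρ₁ ρ₂) (ρ₁ ⟨$⟩ʳ zero) (ρ₁ ⟨$⟩ʳ suc r))
  (w′-bypasses : ∀ r → w′ r ≡ bypassWeight (rho0 ρ₁ ρ₂) (ρ₁ ⟨$⟩ʳ zero) (vertexWeight ρ₁ w) (ρ₁ ⟨$⟩ʳ suc r)) where

  a : Fin (suc n)
  a = ρ₁ ⟨$⟩ʳ zero
  f : Fin (suc n) → Fin (suc n)
  f = rho0 ρ₁ ρ₂
  ρ₁′ σ′ : Permutation′ n
  ρ₁′ = remove zero ρ₁
  σ′ = remove zero σ
  f′ : Fin n → Fin n
  f′ = rho0 ρ₁′ σ′

  f′-bypasses : ∀ y → punchIn a (f′ y) ≡ bypass f a (punchIn a y)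
  f′-bypasses y = begin
    punchIn a (σ′ ⟨$⟩ʳ (ρ₁′ ⟨$⟩ˡ y))        ≡⟨ cong (λ p → punchIn p (σ′ ⟨$⟩ʳ (ρ₁′ ⟨$⟩ˡ y))) σ₀≡a ⟨
    punchIn (σ ⟨$⟩ʳ zero) (σ′ ⟨$⟩ʳ (ρ₁′ ⟨$⟩ˡ y)) ≡⟨ permute-suc σ _ ⟨
    σ ⟨$⟩ʳ suc (ρ₁′ ⟨$⟩ˡ y)                ≡⟨ σ-bypasses _ ⟩
    bypass f a (ρ₁ ⟨$⟩ʳ suc (ρ₁′ ⟨$⟩ˡ y))   ≡⟨ cong (bypass f a) (permute-suc-inverse ρ₁ y) ⟩
    bypass f a (punchIn a y)               ∎

  v′-bypasses : ∀ y → vertexWeight ρ₁′ w′ y ≡ bypassWeight f a (vertexWeight ρ₁ w) (punchIn a y)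
  v′-bypasses y = trans (w′-bypasses _) (cong (bypassWeight f a (vertexWeight ρ₁ w)) (permute-suc-inverse ρ₁ y))

  open Cycles f (rho0-injective ρ₁ ρ₂) public
  open Bypass f (rho0-injective ρ₁ ρ₂) a f′ (rho0-injective ρ₁′ σ′) f′-bypasses public

  singular⇔ : HasSingularCycle (vertexWeight ρ₁ w) ⇔
              ((f a ≡ a × - vertexWeight ρ₁ w a ≡ 1ℤ) ⊎ ′.HasSingularCycle (vertexWeight ρ₁′ w′))
  singular⇔ = hasSingularCycle-bypass (vertexWeight ρ₁ w) (vertexWeight ρ₁′ w′) v′-bypasses

  weight-a : vertexWeight ρ₁ w a ≡ w zero
  weight-a = vertexWeight-permute ρ₁ w zero

DetFormulaFor : ℕ → Set
DetFormulaFor n = ∀ (ρ₁ ρ₂ : Permutation′ n) w → (∀ i → PlusMinusOne (w i)) → DetFormula ρ₁ ρ₂ w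

detFormula-coincident : ∀ {n} → DetFormulaFor n → ∀ (ρ₁ ρ₂ : Permutation′ (suc n)) w → (∀ i → PlusMinusOne (w i)) →
  ρ₁ ⟨$⟩ʳ zero ≡ ρ₂ ⟨$⟩ʳ zero → DetFormula ρ₁ ρ₂ w
detFormula-coincident {n} induction-hypothesis ρ₁ ρ₂ w ±1 a≡c = singular⇒0 , nonsingular⇒formula
  where
  f-permute-suc≢a : ∀ r → rho0 ρ₁ ρ₂ (ρ₁ ⟨$⟩ʳ suc r) ≢ ρ₁ ⟨$⟩ʳ zero
  f-permute-suc≢a r eq = permute-suc≢permute-zero ρ₂ r (trans (sym (rho0-permute ρ₁ ρ₂ (suc r))) (trans eq a≡c))
  open Reduction ρ₁ ρ₂ ρ₂ w (w ∘ suc) (sym a≡c)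
    (λ r → sym (trans (bypass-≢ (rho0 ρ₁ ρ₂) (f-permute-suc≢a r)) (rho0-permute ρ₁ ρ₂ (suc r))))
    (λ r → sym (trans (bypassWeight-≢ (rho0 ρ₁ ρ₂) (vertexWeight ρ₁ w) (f-permute-suc≢a r))
                         (vertexWeight-permute ρ₁ w (suc r))))
  s : ℤ
  s = negOnePow (toℕ a)
  A′ : Matrix n
  A′ = weightedCmat ρ₁′ σ′ (w ∘ suc)
  IH : DetFormula ρ₁′ σ′ (w ∘ suc)
  IH = induction-hypothesis ρ₁′ σ′ (w ∘ suc) (±1 ∘ suc)
  expand : det (weightedCmat ρ₁ ρ₂ w) ≡ s * ((1ℤ + w zero) * det A′)
  expand = det-weightedCmat-coincident ρ₁ ρ₂ w a≡c
  fa≡a : f a ≡ a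
  fa≡a = trans (rho0-permute ρ₁ ρ₂ zero) (sym a≡c)
  singular⇒0 : HasSingularCycle (vertexWeight ρ₁ w) → det (weightedCmat ρ₁ ρ₂ w) ≡ 0ℤ
  singular⇒0 singular = [ (λ (_ , -va≡1) → begin
      det (weightedCmat ρ₁ ρ₂ w)        ≡⟨ expand ⟩
      s * ((1ℤ + w zero) * det A′)      ≡⟨ cong (λ x → s * ((1ℤ + x) * det A′)) (w₀≡-1 -va≡1) ⟩
      s * (0ℤ * det A′)                 ≡⟨ ℤₚ.*-zeroʳ s ⟩
      0ℤ                                ∎)
    , (λ singular′ → begin
      det (weightedCmat ρ₁ ρ₂ w)        ≡⟨ expand ⟩
      s * ((1ℤ + w zero) * det A′)      ≡⟨ cong (λ d → s * ((1ℤ + w zero) * d)) (proj₁ IH singular′) ⟩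
      s * ((1ℤ + w zero) * 0ℤ)          ≡⟨ trans (cong (s *_) (ℤₚ.*-zeroʳ (1ℤ + w zero))) (ℤₚ.*-zeroʳ s) ⟩
      0ℤ                                ∎)
    ]′ (to singular⇔ singular)
    where
    w₀≡-1 : - vertexWeight ρ₁ w a ≡ 1ℤ → w zero ≡ -1ℤ
    w₀≡-1 -va≡1 = trans (sym (ℤₚ.neg-involutive (w zero))) (cong -_ (trans (cong -_ (sym weight-a)) -va≡1))
  nonsingular⇒formula : ¬ HasSingularCycle (vertexWeight ρ₁ w) → det (weightedCmat ρ₁ ρ₂ w) ≡ sign ρ₁ * (+ 2) ^ cl f
  nonsingular⇒formula nonsingular = begin
    det (weightedCmat ρ₁ ρ₂ w)                      ≡⟨ expand ⟩
    s * ((1ℤ + w zero) * det A′)                    ≡⟨ cong₂ (λ x d → s * ((1ℤ + x) * d)) w₀≡1 (proj₂ IH (nonsingular ∘ from singular⇔ ∘ inj₂)) ⟩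
    s * ((1ℤ + 1ℤ) * (sign ρ₁′ * (+ 2) ^ cl f′))     ≡⟨ regroup s (sign ρ₁′) ((+ 2) ^ cl f′) ⟩
    (s * sign ρ₁′) * ((+ 2) * (+ 2) ^ cl f′)           ≡⟨ cong₂ (λ g k → g * (+ 2) ^ k) (sign-remove-zero ρ₁) (cl-bypass-fixed fa≡a) ⟨
    sign ρ₁ * (+ 2) ^ cl f                            ∎
    where
    regroup : ∀ s g p → s * ((1ℤ + 1ℤ) * (g * p)) ≡ (s * g) * ((+ 2) * p)
    regroup = solve-∀
    w₀≡1 : w zero ≡ 1ℤ
    w₀≡1 with ±1 zero
    ... | inj₁ w₀≡1  = w₀≡1
    ... | inj₂ w₀≡-1 = ⊥-elim (nonsingular (from singular⇔ (inj₁ (fa≡a , cong -_ (trans weight-a w₀≡-1)))))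

detFormula-distinct : ∀ {n} → DetFormulaFor n → ∀ (ρ₁ ρ₂ : Permutation′ (suc n)) w → (∀ i → PlusMinusOne (w i)) →
  ρ₁ ⟨$⟩ʳ zero ≢ ρ₂ ⟨$⟩ʳ zero → DetFormula ρ₁ ρ₂ w
detFormula-distinct induction-hypothesis ρ₁ ρ₂ w ±1 a≢c = singular⇒0 , nonsingular⇒formula
  where
  open Distinct ρ₁ ρ₂ w a≢c using (σ; w̃; σ-zero; σ-bypasses; w̃-≡; w̃-≢; det-weightedCmat-distinct)
  open Reduction ρ₁ ρ₂ σ w (w̃ ∘ suc) σ-zero σ-bypasses (λ _ → refl)
  s : ℤ
  s = negOnePow (toℕ a)
  ±1′ : ∀ r → PlusMinusOne (w̃ (suc r))
  ±1′ r with ρ₂ ⟨$⟩ʳ suc r ≟ a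
  ... | yes ρ₂s≡a = subst PlusMinusOne (sym (w̃-≡ ρ₂s≡a)) (plusMinusOne-neg-* (±1 zero) (±1 (suc r)))
  ... | no  ρ₂s≢a = subst PlusMinusOne (sym (w̃-≢ ρ₂s≢a)) (±1 (suc r))
  IH : DetFormula ρ₁′ σ′ (w̃ ∘ suc)
  IH = induction-hypothesis ρ₁′ σ′ (w̃ ∘ suc) ±1′
  fa≢a : f a ≢ a
  fa≢a fa≡a = a≢c (trans (sym fa≡a) (rho0-permute ρ₁ ρ₂ zero))
  singular⇒0 : HasSingularCycle (vertexWeight ρ₁ w) → det (weightedCmat ρ₁ ρ₂ w) ≡ 0ℤ
  singular⇒0 singular = [ (λ (fa≡a , _) → ⊥-elim (fa≢a fa≡a))
                         , (λ singular′ → trans det-weightedCmat-distinct (trans (cong (s *_) (proj₁ IH singular′)) (ℤₚ.*-zeroʳ s)))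
                         ]′ (to singular⇔ singular)
  nonsingular⇒formula : ¬ HasSingularCycle (vertexWeight ρ₁ w) → det (weightedCmat ρ₁ ρ₂ w) ≡ sign ρ₁ * (+ 2) ^ cl f
  nonsingular⇒formula nonsingular = begin
    det (weightedCmat ρ₁ ρ₂ w)                  ≡⟨ det-weightedCmat-distinct ⟩
    s * det (weightedCmat ρ₁′ σ′ (w̃ ∘ suc))     ≡⟨ cong (s *_) (proj₂ IH (nonsingular ∘ from singular⇔ ∘ inj₂)) ⟩
    s * (sign ρ₁′ * (+ 2) ^ cl f′)                ≡⟨ ℤₚ.*-assoc s (sign ρ₁′) _ ⟨
    (s * sign ρ₁′) * (+ 2) ^ cl f′                ≡⟨ cong₂ (λ g k → g * (+ 2) ^ k) (sign-remove-zero ρ₁) (cl-bypass-moved fa≢a) ⟨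
    sign ρ₁ * (+ 2) ^ cl f                        ∎

det-weightedCmat : ∀ n → DetFormulaFor n
det-weightedCmat zero    ρ₁ ρ₂ w _  = (λ { (() , _) }) , λ _ → refl
det-weightedCmat (suc n) ρ₁ ρ₂ w ±1 with ρ₁ ⟨$⟩ʳ zero ≟ ρ₂ ⟨$⟩ʳ zero
... | yes a≡c = detFormula-coincident (det-weightedCmat n) ρ₁ ρ₂ w ±1 a≡c
... | no  a≢c = detFormula-distinct (det-weightedCmat n) ρ₁ ρ₂ w ±1 a≢c

theorem2p11 : (n : ℕ) (ρ₁ ρ₂ : Permutation′ n) →
    (HasEvenCycle (rho0 ρ₁ ρ₂) → det (Cmat ρ₁ ρ₂) ≡ + 0) ×
    (¬ HasEvenCycle (rho0 ρ₁ ρ₂) → det (Cmat ρ₁ ρ₂) ≡ sign ρ₁ * (+ 2) ^ cl (rho0 ρ₁ ρ₂))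
theorem2p11 n ρ₁ ρ₂ =
  (λ even → trans (det-Cmat≡det-weightedCmat ρ₁ ρ₂) (proj₁ formula (from singular⇔even even))) ,
  (λ ¬even → trans (det-Cmat≡det-weightedCmat ρ₁ ρ₂) (proj₂ formula (¬even ∘ to singular⇔even)))
  where
  open Cycles (rho0 ρ₁ ρ₂) (rho0-injective ρ₁ ρ₂) using () renaming (hasSingularCycle⇔hasEvenCycle to singular⇔even)
  formula : DetFormula ρ₁ ρ₂ (λ _ → 1ℤ)
  formula = det-weightedCmat n ρ₁ ρ₂ (λ _ → 1ℤ) (λ _ → inj₁ refl)
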